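{- Let $G$ be a $2$-connected graph, let $u$ and $v$ be vertices of $G$, let $\mathcal{C}$ be a set of cycles of $G$, and let $\sigma$ be a cycle of $G$ having Property $\Delta^*$ with respect to $\mathcal{C}$. Then $\mathcal{P}_{\mathcal{C}\cup\{\sigma\}}(G_{uv})$ is connected if and only if $\mathcal{P}_{\mathcal{C}}(G_{uv})$ is connected.
   Context: For a path $L$ and vertices $x,y$ on $L$, $L_{xy}$ denotes the subpath of $L$ joining $x$ and $y$. For vertices $u,v$ of a $2$-connected graph $G$, the $uv$ path graph $\mathcal{P}(G_{uv})$ has as vertices the paths in $G$ joining $u$ and $v$, where two such paths $S$ and $T$ are adjacent if $T$ is obtained from $S$ by replacing a subpath $S_{xy}$ of $S$ with a subpath $T_{xy}$ of $T$ internally disjoint from $S_{xy}$; in that case $S\cup T$ contains a unique cycle, namely $S\Delta T$ (where $F\Delta H$ is the subgraph induced by the edges in exactly one of $F,H$). For a set $\mathcal{C}$ of cycles of $G$, $\mathcal{P}_\mathcal{C}(G_{uv})$ is the spanning subgraph of $\mathcal{P}(G_{uv})$ in which adjacent paths $S,T$ remain adjacent if and only if the unique cycle contained in $S\cup T$ belongs to $\mathcal{C}$. A unicycle of a connected graph $G$ is a spanning subgraph of $G$ containing a unique cycle. A cycle $\sigma$ of $G$ has Property $\Delta^*$ with respect to $\mathcal{C}$ if for every unicycle $\mathcal{U}$ of $G$ containing $\sigma$ there exist an edge $e$ of $G$ not in $\mathcal{U}$ and two cycles $\alpha,\beta\in\mathcal{C}$, both contained in $\mathcal{U}+e$, such that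 $\sigma=\alpha\Delta\beta$. -}

module Defs where

open import Data.Nat using (ℕ; _≤_)
open import Data.Bool using (Bool; true; false; _∧_; _∨_; _xor_)
open import Data.Fin using (Fin; _≟_)
open import Data.Vec using (Vec; lookup; tabulate; zipWith)
open import Data.List using (List; []; _∷_; _++_; [_]; length)
open import Data.List.Membership.Propositional using (_∈_; _∉_)
open import Data.List.Relation.Unary.Unique.Propositional using (Unique)
open import Data.Product using (Σ; ∃; _×_; _,_)
open import Data.Sum using (_⊎_)
open import Relation.Nullary using (¬_)
open import Relation.Nullary.Decidable using (⌊_⌋)
open import Relation.Binary.PropositionalEquality using (_≡_; _≢_)
open import Relation.Binary.Construct.Closure.ReflexiveTransitive using (Star)

-- Edge sets on the vertex set Fin n, as (canonical) Boolean adjacency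
-- matrices.  Entry (i , j) is true iff {i , j} is an edge.

Mat : ℕ → Set
Mat n = Vec (Vec Bool n) n

entry : ∀ {n} → Mat n → Fin n → Fin n → Bool
entry M i j = lookup (lookup M i) j

_⊆ᴱ_ : ∀ {n} → Mat n → Mat n → Set
H ⊆ᴱ K = ∀ i j → entry H i j ≡ true → entry K i j ≡ true

Symmetric : ∀ {n} → Mat n → Set
Symmetric M = ∀ i j → entry M i j ≡ entry M j i

_Δ_ : ∀ {n} → Mat n → Mat n → Mat n
F Δ H = zipWith (zipWith _xor_) F H

addEdge : ∀ {n} → Mat n → Fin n → Fin n → Mat n
addEdge M a b = tabulate λ i → tabulate λ j →
  entry M i j ∨ ((⌊ i ≟ a ⌋ ∧ ⌊ j ≟ b ⌋) ∨ (⌊ i ≟ b ⌋ ∧ ⌊ j ≟ a ⌋))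

record Graph (n : ℕ) : Set where
  field
    adj   : Mat n
    sym   : Symmetric adj
    irrefl : ∀ i → entry adj i i ≡ false
open Graph public

Edge : ∀ {n} → Graph n → Fin n → Fin n → Set
Edge G i j = entry (adj G) i j ≡ true

data Chain {n} (G : Graph n) : List (Fin n) → Set where
  nil    : Chain G []
  single : ∀ x → Chain G [ x ]
  step   : ∀ {x y xs} → Edge G x y → Chain G (y ∷ xs) → Chain G (x ∷ y ∷ xs)

data WalkFromTo {n} : Fin n → Fin n → List (Fin n) → Set where
  one  : ∀ x → WalkFromTo x x [ x ]
  cons : ∀ {x y z zs} → WalkFromTo y z zs → WalkFromTo x z (x ∷ zs)

consec : ∀ {n} → List (Fin n) → Fin n → Fin n → Bool
consec []            i j = false
consec (a ∷ [])      i j = false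
consec (a ∷ b ∷ xs)  i j =
  ((⌊ i ≟ a ⌋ ∧ ⌊ j ≟ b ⌋) ∨ (⌊ i ≟ b ⌋ ∧ ⌊ j ≟ a ⌋)) ∨ consec (b ∷ xs) i j

edgesOf : ∀ {n} → List (Fin n) → Mat n
edgesOf p = tabulate λ i → tabulate λ j → consec p i j

Connected : ∀ {n} → Graph n → Set
Connected G = ∀ x y → ∃ λ p → WalkFromTo x y p × Chain G p

TwoConnected : ∀ {n} → Graph n → Set
TwoConnected {n} G =
  3 ≤ n × Connected G ×
  (∀ w x y → x ≢ w → y ≢ w →
     ∃ λ p → WalkFromTo x y p × Chain G p × w ∉ p)

IsPath : ∀ {n} → Graph n → Fin n → Fin n → List (Fin n) → Set
IsPath G u v p = WalkFromTo u v p × Chain G p × Unique p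

IsCycle : ∀ {n} → Graph n → Mat n → Set
IsCycle G σ = Σ _ λ c → Σ _ λ x →
  3 ≤ length c × Unique c × WalkFromTo x x (c ++ [ x ]) ×
  Chain G (c ++ [ x ]) × σ ≡ edgesOf (c ++ [ x ])
  -- here c starts with x, so c ++ [ x ] closes the cycle

UVPath : ∀ {n} → Graph n → Fin n → Fin n → Set
UVPath G u v = Σ (List _) (IsPath G u v)

Adjacent : ∀ {n} {G : Graph n} {u v} → UVPath G u v → UVPath G u v → Set
Adjacent (S , _) (T , _) =
  S ≢ T ×
  (Σ _ λ A → Σ _ λ B → Σ _ λ x → Σ _ λ y → Σ _ λ X → Σ _ λ Y →
     S ≡ A ++ x ∷ X ++ y ∷ B × T ≡ A ++ x ∷ Y ++ y ∷ B ×
     (∀ z → z ∈ X → z ∉ Y))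

-- adjacency in P_C(G_uv): the unique cycle S Δ T of S ∪ T lies in C
AdjacentC : ∀ {n} {G : Graph n} {u v} → (Mat n → Set) →
            UVPath G u v → UVPath G u v → Set
AdjacentC C S T = Adjacent S T × C (edgesOf (Data.Product.proj₁ S) Δ edgesOf (Data.Product.proj₁ T))

PathGraphConnected : ∀ {n} (G : Graph n) (u v : Fin n) → (Mat n → Set) → Set
PathGraphConnected G u v C = ∀ S T → Star (AdjacentC {G = G} {u} {v} C) S T

IsSpanningSubgraph : ∀ {n} → Graph n → Mat n → Set
IsSpanningSubgraph G U = Symmetric U × U ⊆ᴱ adj G

IsUnicycle : ∀ {n} → Graph n → Mat n → Set
IsUnicycle G U = IsSpanningSubgraph G U ×
  (Σ _ λ γ → (IsCycle G γ × γ ⊆ᴱ U) ×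
     (∀ γ′ → IsCycle G γ′ → γ′ ⊆ᴱ U → γ′ ≡ γ))

PropertyΔ* : ∀ {n} → Graph n → (Mat n → Set) → Mat n → Set
PropertyΔ* G C σ = ∀ U → IsUnicycle G U → σ ⊆ᴱ U →
  Σ _ λ a → Σ _ λ b → Edge G a b × entry U a b ≡ false ×
  Σ _ λ α → Σ _ λ β → C α × C β ×
  α ⊆ᴱ addEdge U a b × β ⊆ᴱ addEdge U a b × σ ≡ α Δ β

_∪｛_｝ : ∀ {n} → (Mat n → Set) → Mat n → (Mat n → Set)
(C ∪｛ σ ｝) τ = C τ ⊎ τ ≡ σ

{-# OPTIONS --safe #-}
-- Adding σ to C only adds edges to the path graph, so one direction is monotonicity.
-- Conversely it suffices to replace each σ-step S — T (so S Δ T = σ) by a path of C-steps.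
-- The cycle σ is itself a unicycle, so Property Δ* yields an edge ab ∉ σ and α, β ∈ C inside
-- σ + ab with σ = α Δ β. Were a or b off σ, both α and β would equal σ; so ab is a chord, and
-- α, β are the two cycles of the theta graph σ + ab through ab. As σ is the union of the
-- S-segment and the T-segment between the vertices x, y where S and T part, either both ends of
-- the chord lie on one segment or one end lies inside each. In every case rerouting through ab
-- gives a uv-path R with {S Δ R, R Δ T} = {α, β}, i.e. two C-steps S — R — T.

module Submission where

open import Defs hiding (sym)
open import Function.Bundles using (_⇔_; mk⇔)
open import Data.Nat using (ℕ; s≤s; _≤_)
open import Data.Nat.Properties using (suc-injective)
open import Data.Bool using (Bool; true; false; _∧_; _∨_; _xor_)
open import Function.Base using (_∘_; id)
open import Data.Bool.Properties using (∨-comm; ∨-assoc; ∨-identityʳ; ∨-conicalˡ; ∨-conicalʳ; ∧-comm; ∧-conicalˡ; ∧-conicalʳ; xor-comm; xor-assoc; xor-identityʳ; xor-same; not-involutive)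
open import Data.Fin using (Fin; _≟_)
open import Data.List using (List; []; _∷_; _++_; [_]; reverse; length)
open import Data.List.Relation.Binary.Permutation.Propositional.Properties using (↭-length) renaming (++-comm to ↭-++-comm)
open import Data.List.Properties using (++-assoc; ++-identityʳ; reverse-++; unfold-reverse; ∷-injective)
open import Data.List.Relation.Unary.Any using (here; there)
import Data.List.Relation.Unary.Any.Properties as Any
open import Data.List.Relation.Unary.All.Properties using (¬Any⇒All¬; All¬⇒¬Any)
open import Data.List.Relation.Unary.AllPairs using ([]; _∷_)
import Data.List.Relation.Unary.AllPairs as AllPairs
open import Data.List.Relation.Unary.Unique.Propositional using (Unique)
import Data.List.Relation.Unary.Unique.Propositional.Properties as Unique
open import Data.List.Membership.Propositional using (_∈_; _∉_)
open import Data.List.Membership.Propositional.Properties using (∈-++⁺ˡ; ∈-++⁺ʳ; ∈-++⁻; ∈-∃++)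
import Data.List.Membership.DecPropositional as DecMembership
open import Data.Vec using (Vec; lookup; zipWith)
open import Data.Vec.Properties using (lookup∘tabulate; lookup-zipWith; tabulate∘lookup; tabulate-cong)
open import Data.Product using (Σ; _×_; _,_; proj₁; proj₂; map; map₁)
open import Data.Sum using (_⊎_; inj₁; inj₂; [_,_]′)
open import Data.Empty using (⊥; ⊥-elim)
open import Data.Unit using (⊤; tt)
open import Relation.Nullary using (¬_; yes; no; Dec)
open import Relation.Nullary.Decidable using (⌊_⌋)
open import Relation.Binary.Construct.Closure.ReflexiveTransitive using (Star; ε; _◅_; _◅◅_)
import Relation.Binary.Construct.Closure.ReflexiveTransitive as Star
open import Relation.Binary.PropositionalEquality hiding ([_])

false≢true : false ≢ true
false≢true ()

∨-true⁻ : ∀ {x y} → x ∨ y ≡ true → x ≡ true ⊎ y ≡ true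
∨-true⁻ {true}  _ = inj₁ refl
∨-true⁻ {false} p = inj₂ p

∨-trueˡ : ∀ {x} y → x ≡ true → x ∨ y ≡ true
∨-trueˡ _ refl = refl

∨-trueʳ : ∀ x {y} → y ≡ true → x ∨ y ≡ true
∨-trueʳ true  _ = refl
∨-trueʳ false p = p

∧-true⁻ : ∀ {x y} → x ∧ y ≡ true → x ≡ true × y ≡ true
∧-true⁻ {x} {y} p = ∧-conicalˡ x y p , ∧-conicalʳ x y p

∧-true⁺ : ∀ {x y} → x ≡ true → y ≡ true → x ∧ y ≡ true
∧-true⁺ refl refl = refl

≡-from-truth : ∀ {x y} → (x ≡ true → y ≡ true) → (y ≡ true → x ≡ true) → x ≡ y
≡-from-truth {true}  {true}  f g = refl
≡-from-truth {true}  {false} f g = sym (f refl)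
≡-from-truth {false} {true}  f g = g refl
≡-from-truth {false} {false} f g = refl

∨≡xor : ∀ x y → (x ≡ true → y ≡ true → ⊥) → x ∨ y ≡ x xor y
∨≡xor true  true  f = ⊥-elim (f refl refl)
∨≡xor true  false f = refl
∨≡xor false y     f = refl

xor-cancelˡ : ∀ s s′ t → (s xor s′) xor (s xor t) ≡ s′ xor t
xor-cancelˡ false s′    t = refl
xor-cancelˡ true  true  t = refl
xor-cancelˡ true  false t = not-involutive t

xor-regroup : ∀ p e q → p xor ((e ∨ false) xor q) ≡ (p xor q) xor e
xor-regroup p true  q = trans (cong (p xor_) (xor-comm true q)) (sym (xor-assoc p q true))
xor-regroup p false q = sym (xor-identityʳ (p xor q))

∨-xor-disjoint : ∀ r₁ r₂ e → (r₁ ≡ true → r₂ ≡ true → ⊥) → (r₁ ≡ true → e ≡ true → ⊥) →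
                 (r₂ ≡ true → e ≡ true → ⊥) → r₂ ∨ e ≡ (r₁ ∨ e) xor (r₁ ∨ r₂)
∨-xor-disjoint true  true  e     f g h = ⊥-elim (f refl refl)
∨-xor-disjoint true  false true  f g h = ⊥-elim (g refl refl)
∨-xor-disjoint true  false false f g h = refl
∨-xor-disjoint false true  true  f g h = ⊥-elim (h refl refl)
∨-xor-disjoint false true  false f g h = refl
∨-xor-disjoint false false true  f g h = refl
∨-xor-disjoint false false false f g h = refl

xor-cancel-outer : ∀ a b c d → (a xor (b xor c)) xor (a xor (d xor c)) ≡ b xor d
xor-cancel-outer a b c d = begin
  (a xor (b xor c)) xor (a xor (d xor c)) ≡⟨ xor-cancelˡ a (b xor c) (d xor c) ⟩
  (b xor c) xor (d xor c)                 ≡⟨ cong₂ _xor_ (xor-comm b c) (xor-comm d c) ⟩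
  (c xor b) xor (c xor d)                 ≡⟨ xor-cancelˡ c b d ⟩
  b xor d                                 ∎
  where open ≡-Reasoning

module _ {n : ℕ} where

  private
    V : Set
    V = Fin n

  -- Edge sets of vertex lists

  Edges : Set
  Edges = V → V → Bool

  _≐_ : Edges → Edges → Set
  γ ≐ δ = ∀ i j → γ i j ≡ δ i j

  _⊆ₑ_ : Edges → Edges → Set
  γ ⊆ₑ δ = ∀ i j → γ i j ≡ true → δ i j ≡ true

  _∪ₑ_ : Edges → Edges → Edges
  (γ ∪ₑ δ) i j = γ i j ∨ δ i j

  _⊕_ : Edges → Edges → Edges
  (γ ⊕ δ) i j = γ i j xor δ i j

  IsSymmetric : Edges → Set
  IsSymmetric γ = ∀ i j → γ i j ≡ γ j i

  link : V → V → Edges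
  link a b i j = (⌊ i ≟ a ⌋ ∧ ⌊ j ≟ b ⌋) ∨ (⌊ i ≟ b ⌋ ∧ ⌊ j ≟ a ⌋)

  ≟-true⁻ : ∀ (i a : V) → ⌊ i ≟ a ⌋ ≡ true → i ≡ a
  ≟-true⁻ i a p with i ≟ a
  ... | yes q = q
  ... | no  _ = ⊥-elim (false≢true p)

  ≟-refl : ∀ (a : V) → ⌊ a ≟ a ⌋ ≡ true
  ≟-refl a with a ≟ a
  ... | yes _ = refl
  ... | no  q = ⊥-elim (q refl)

  link⁻ : ∀ {a b i j} → link a b i j ≡ true → (i ≡ a × j ≡ b) ⊎ (i ≡ b × j ≡ a)
  link⁻ {a} {b} {i} {j} p with ∨-true⁻ {⌊ i ≟ a ⌋ ∧ ⌊ j ≟ b ⌋} p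
  ... | inj₁ q = let (q₁ , q₂) = ∧-true⁻ q in inj₁ (≟-true⁻ i a q₁ , ≟-true⁻ j b q₂)
  ... | inj₂ q = let (q₁ , q₂) = ∧-true⁻ q in inj₂ (≟-true⁻ i b q₁ , ≟-true⁻ j a q₂)

  link-ab : ∀ a b → link a b a b ≡ true
  link-ab a b rewrite ≟-refl a | ≟-refl b = refl

  link-ba : ∀ a b → link a b b a ≡ true
  link-ba a b rewrite ≟-refl a | ≟-refl b = ∨-trueʳ (⌊ b ≟ a ⌋ ∧ ⌊ a ≟ b ⌋) refl

  link-sym : ∀ a b → IsSymmetric (link a b)
  link-sym a b i j = trans (∨-comm (⌊ i ≟ a ⌋ ∧ ⌊ j ≟ b ⌋) _)
                           (cong₂ _∨_ (∧-comm ⌊ i ≟ b ⌋ _) (∧-comm ⌊ i ≟ a ⌋ _))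

  link-swap : ∀ a b → link a b ≐ link b a
  link-swap a b i j = ∨-comm (⌊ i ≟ a ⌋ ∧ ⌊ j ≟ b ⌋) (⌊ i ≟ b ⌋ ∧ ⌊ j ≟ a ⌋)

  link-⊆ : ∀ {a b} {γ : Edges} → IsSymmetric γ → γ a b ≡ true → link a b ⊆ₑ γ
  link-⊆ {a} {b} symγ g i j e with link⁻ {a} {b} {i} {j} e
  ... | inj₁ (refl , refl) = g
  ... | inj₂ (refl , refl) = trans (symγ b a) g

  non-endpoint⇒link-false : ∀ {a b w} r → w ≢ a → w ≢ b → link a b w r ≡ false
  non-endpoint⇒link-false {a} {b} {w} r w≢a w≢b with link a b w r in eq
  ... | false = refl
  ... | true with link⁻ {a} {b} {w} {r} eq
  ...   | inj₁ (e , _) = ⊥-elim (w≢a e)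
  ...   | inj₂ (e , _) = ⊥-elim (w≢b e)

  consec-++ : ∀ (l₁ : List V) z l₂ → consec (l₁ ++ z ∷ l₂) ≐ (consec (l₁ ++ [ z ]) ∪ₑ consec (z ∷ l₂))
  consec-++ []           z l₂ i j = refl
  consec-++ (a ∷ [])     z l₂ i j = cong (_∨ consec (z ∷ l₂) i j) (sym (∨-identityʳ (link a z i j)))
  consec-++ (a ∷ b ∷ l₁) z l₂ i j =
    trans (cong (link a b i j ∨_) (consec-++ (b ∷ l₁) z l₂ i j)) (sym (∨-assoc (link a b i j) _ _))

  consec-sym : ∀ (l : List V) → IsSymmetric (consec l)
  consec-sym []          i j = refl
  consec-sym (a ∷ [])    i j = refl
  consec-sym (a ∷ b ∷ l) i j = cong₂ _∨_ (link-sym a b i j) (consec-sym (b ∷ l) i j)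

  link⇒∈ : ∀ {a b i j} (l : List V) → link a b i j ≡ true → i ∈ a ∷ b ∷ l × j ∈ a ∷ b ∷ l
  link⇒∈ {a} {b} {i} {j} l q with link⁻ {a} {b} {i} {j} q
  ... | inj₁ (refl , refl) = here refl , there (here refl)
  ... | inj₂ (refl , refl) = there (here refl) , here refl

  consec⇒∈ : ∀ (l : List V) {i j} → consec l i j ≡ true → i ∈ l × j ∈ l
  consec⇒∈ []       ()
  consec⇒∈ (a ∷ []) ()
  consec⇒∈ (a ∷ l@(b ∷ l′)) {i} {j} p =
    [ link⇒∈ l′ , (λ q → map there there (consec⇒∈ l q)) ]′ (∨-true⁻ {link a b i j} p)

  Chain⇒Edge : ∀ {G : Graph n} (l : List V) → Chain G l → ∀ {i j} → consec l i j ≡ true → Edge G i j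
  Chain⇒Edge []       _ ()
  Chain⇒Edge (a ∷ []) _ ()
  Chain⇒Edge {G} (a ∷ l@(b ∷ _)) (step e ch) {i} {j} p =
    [ link-⊆ (Graph.sym G) e i j , Chain⇒Edge l ch ]′ (∨-true⁻ {link a b i j} p)

  closed : V → List V → List V
  closed x Z = x ∷ Z ++ [ x ]

  consec-rotate : ∀ x P w Q → consec (closed x (P ++ w ∷ Q)) ≐ consec (closed w (Q ++ x ∷ P))
  consec-rotate x P w Q i j = begin
    consec (x ∷ (P ++ w ∷ Q) ++ [ x ]) i j               ≡⟨ cong (λ t → consec (x ∷ t) i j) (++-assoc P (w ∷ Q) [ x ]) ⟩
    consec ((x ∷ P) ++ w ∷ (Q ++ [ x ])) i j             ≡⟨ consec-++ (x ∷ P) w (Q ++ [ x ]) i j ⟩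
    consec (x ∷ P ++ [ w ]) i j ∨ consec (w ∷ Q ++ [ x ]) i j
                                                         ≡⟨ ∨-comm (consec (x ∷ P ++ [ w ]) i j) _ ⟩
    consec (w ∷ Q ++ [ x ]) i j ∨ consec (x ∷ P ++ [ w ]) i j
                                                         ≡⟨ sym (consec-++ (w ∷ Q) x (P ++ [ w ]) i j) ⟩
    consec ((w ∷ Q) ++ x ∷ (P ++ [ w ])) i j             ≡⟨ cong (λ t → consec (w ∷ t) i j) (sym (++-assoc Q (x ∷ P) [ w ])) ⟩
    consec (w ∷ (Q ++ x ∷ P) ++ [ w ]) i j               ∎
    where open ≡-Reasoning

  consec-reverse : ∀ (l : List V) → consec (reverse l) ≐ consec l
  consec-reverse []          i j = refl
  consec-reverse (a ∷ [])    i j = refl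
  consec-reverse (a ∷ b ∷ l) i j = begin
    consec (reverse (a ∷ b ∷ l)) i j               ≡⟨ cong (λ t → consec t i j) (unfold-reverse a (b ∷ l)) ⟩
    consec (reverse (b ∷ l) ++ [ a ]) i j          ≡⟨ cong (λ t → consec (t ++ [ a ]) i j) (unfold-reverse b l) ⟩
    consec ((reverse l ++ [ b ]) ++ [ a ]) i j     ≡⟨ cong (λ t → consec t i j) (++-assoc (reverse l) [ b ] [ a ]) ⟩
    consec (reverse l ++ b ∷ [ a ]) i j            ≡⟨ consec-++ (reverse l) b [ a ] i j ⟩
    consec (reverse l ++ [ b ]) i j ∨ (link b a i j ∨ false)
      ≡⟨ cong₂ _∨_ (trans (cong (λ t → consec t i j) (sym (unfold-reverse b l))) (consec-reverse (b ∷ l) i j))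
                   (trans (∨-identityʳ _) (link-swap b a i j)) ⟩
    consec (b ∷ l) i j ∨ link a b i j              ≡⟨ ∨-comm (consec (b ∷ l) i j) _ ⟩
    consec (a ∷ b ∷ l) i j                         ∎
    where open ≡-Reasoning

  _#_ : List V → List V → Set
  l₁ # l₂ = ∀ {z} → z ∈ l₁ → z ∉ l₂

  infix 4 _#_

  Unique-∷⁺ : ∀ {x} {xs : List V} → x ∉ xs → Unique xs → Unique (x ∷ xs)
  Unique-∷⁺ {xs = xs} x∉xs u = ¬Any⇒All¬ xs x∉xs ∷ u

  Unique-[_] : ∀ (x : V) → Unique [ x ]
  Unique-[ x ] = Unique-∷⁺ (λ ()) []

  Unique-++⁻ : ∀ (l₁ : List V) {l₂} → Unique (l₁ ++ l₂) →
               Unique l₁ × Unique l₂ × l₁ # l₂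
  Unique-++⁻ []       u        = [] , u , λ ()
  Unique-++⁻ (x ∷ l₁) {l₂} (px ∷ u) with Unique-++⁻ l₁ u
  ... | u₁ , u₂ , disj = Unique-∷⁺ (x∉ ∘ ∈-++⁺ˡ) u₁ , u₂ , disj′
    where
    x∉ : x ∉ l₁ ++ l₂
    x∉ = All¬⇒¬Any px
    disj′ : (x ∷ l₁) # l₂
    disj′ (here refl) m = x∉ (∈-++⁺ʳ l₁ m)
    disj′ (there m₁)  m = disj m₁ m

  Unique-++⁺ : ∀ {l₁ l₂ : List V} → Unique l₁ → Unique l₂ → l₁ # l₂ → Unique (l₁ ++ l₂)
  Unique-++⁺ u₁ u₂ disj = Unique.++⁺ u₁ u₂ (λ (m₁ , m₂) → disj m₁ m₂)

  Unique-swap : ∀ (l₁ l₂ : List V) → Unique (l₁ ++ l₂) → Unique (l₂ ++ l₁)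
  Unique-swap l₁ l₂ u with Unique-++⁻ l₁ u
  ... | u₁ , u₂ , disj = Unique-++⁺ u₂ u₁ (λ m₂ m₁ → disj m₁ m₂)

  Unique-reverse : ∀ (l : List V) → Unique l → Unique (reverse l)
  Unique-reverse []      u        = u
  Unique-reverse (x ∷ l) (px ∷ u) rewrite unfold-reverse x l =
    Unique-++⁺ (Unique-reverse l u) Unique-[ x ] (λ { m (here refl) → All¬⇒¬Any px (Any.reverse⁻ m) })

  consec-irrefl : ∀ (l : List V) {i j} → Unique l → consec l i j ≡ true → i ≢ j
  consec-irrefl (a ∷ l@(b ∷ _)) {i} {j} (pa ∷ u) q =
    [ link-irrefl , consec-irrefl l u ]′ (∨-true⁻ {link a b i j} q)
    where
    link-irrefl : link a b i j ≡ true → i ≢ j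
    link-irrefl e with link⁻ {a} {b} {i} {j} e
    ... | inj₁ (refl , refl) = λ eq → All¬⇒¬Any pa (here eq)
    ... | inj₂ (refl , refl) = λ eq → All¬⇒¬Any pa (here (sym eq))

  consec-++-xor : ∀ (l₁ : List V) z l₂ → Unique (l₁ ++ z ∷ l₂) →
                  consec (l₁ ++ z ∷ l₂) ≐ (consec (l₁ ++ [ z ]) ⊕ consec (z ∷ l₂))
  consec-++-xor l₁ z l₂ u i j = trans (consec-++ l₁ z l₂ i j) (∨≡xor _ _ edge-disjoint)
    where
    parts : Unique l₁ × Unique (z ∷ l₂) × l₁ # (z ∷ l₂)
    parts = Unique-++⁻ l₁ u
    only-z : ∀ {w} → w ∈ l₁ ++ [ z ] → w ∈ z ∷ l₂ → w ≡ z
    only-z m m′ with ∈-++⁻ l₁ m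
    ... | inj₁ m₁        = ⊥-elim (proj₂ (proj₂ parts) m₁ m′)
    ... | inj₂ (here eq) = eq
    edge-disjoint : consec (l₁ ++ [ z ]) i j ≡ true → consec (z ∷ l₂) i j ≡ true → ⊥
    edge-disjoint p q = consec-irrefl (z ∷ l₂) (proj₁ (proj₂ parts)) q
      (trans (only-z (proj₁ (consec⇒∈ (l₁ ++ [ z ]) p)) (proj₁ (consec⇒∈ (z ∷ l₂) q)))
             (sym (only-z (proj₂ (consec⇒∈ (l₁ ++ [ z ]) p)) (proj₂ (consec⇒∈ (z ∷ l₂) q)))))

  init-last : ∀ (x : V) xs → Σ (List V) λ K → Σ V λ z → x ∷ xs ≡ K ++ [ z ]
  init-last x []       = [] , x , refl
  init-last x (y ∷ xs) with init-last y xs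
  ... | K , z , eq = x ∷ K , z , cong (x ∷_) eq

  split-before-last : ∀ (A : List V) w Q B z → A ++ w ∷ Q ≡ B ++ [ z ] →
                      Σ (List V) λ Q₀ → (w ∷ Q ≡ Q₀ ++ [ z ]) × (B ≡ A ++ Q₀)
  split-before-last []      w Q B       z eq = B , eq , refl
  split-before-last (a ∷ A) w Q []      z eq with A | eq
  ... | []    | ()
  ... | _ ∷ _ | ()
  split-before-last (a ∷ A) w Q (b ∷ B) z eq with ∷-injective eq
  ... | refl , eq′ with split-before-last A w Q B z eq′
  ...   | Q₀ , e₁ , e₂ = Q₀ , e₁ , cong (a ∷_) e₂

  closed-start-neighbours : ∀ z₀ k K kl r → z₀ ∉ k ∷ K ++ [ kl ] →
    consec (closed z₀ (k ∷ K ++ [ kl ])) z₀ r ≡ true → r ≡ k ⊎ r ≡ kl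
  closed-start-neighbours z₀ k K kl r z₀∉ p with ∨-true⁻ {link z₀ k z₀ r} p
  ... | inj₁ q with link⁻ {z₀} {k} {z₀} {r} q
  ...   | inj₁ (_ , r≡k)  = inj₁ r≡k
  ...   | inj₂ (z₀≡k , _) = ⊥-elim (z₀∉ (here z₀≡k))
  closed-start-neighbours z₀ k K kl r z₀∉ p | inj₂ q
    with ∨-true⁻ {consec (k ∷ K ++ [ kl ]) z₀ r}
           (trans (sym (consec-++ (k ∷ K) kl [ z₀ ] z₀ r))
                  (trans (cong (λ t → consec (k ∷ t) z₀ r) (sym (++-assoc K [ kl ] [ z₀ ]))) q))
  ... | inj₁ q′ = ⊥-elim (z₀∉ (proj₁ (consec⇒∈ (k ∷ K ++ [ kl ]) q′)))
  ... | inj₂ q′ with link⁻ {kl} {z₀} {z₀} {r} (trans (sym (∨-identityʳ _)) q′)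
  ...   | inj₁ (z₀≡kl , _) = ⊥-elim (z₀∉ (there (∈-++⁺ʳ K (here z₀≡kl))))
  ...   | inj₂ (_ , r≡kl)  = inj₂ r≡kl

  interior-neighbours : ∀ P w₀ w₁ w₂ Q r → w₁ ∉ P ++ [ w₀ ] → w₁ ∉ w₂ ∷ Q →
    consec (P ++ w₀ ∷ w₁ ∷ w₂ ∷ Q) w₁ r ≡ true → r ≡ w₀ ⊎ r ≡ w₂
  interior-neighbours P w₀ w₁ w₂ Q r before after p
    with ∨-true⁻ {consec (P ++ [ w₀ ]) w₁ r} (trans (sym (consec-++ P w₀ (w₁ ∷ w₂ ∷ Q) w₁ r)) p)
  ... | inj₁ q = ⊥-elim (before (proj₁ (consec⇒∈ (P ++ [ w₀ ]) q)))
  ... | inj₂ q with ∨-true⁻ {link w₀ w₁ w₁ r} q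
  ...   | inj₁ q′ with link⁻ {w₀} {w₁} {w₁} {r} q′
  ...     | inj₁ (w₁≡w₀ , _) = ⊥-elim (before (∈-++⁺ʳ P (here w₁≡w₀)))
  ...     | inj₂ (_ , r≡w₀)  = inj₁ r≡w₀
  interior-neighbours P w₀ w₁ w₂ Q r before after p | inj₂ q | inj₂ q′ with ∨-true⁻ {link w₁ w₂ w₁ r} q′
  ... | inj₂ q″ = ⊥-elim (after (proj₁ (consec⇒∈ (w₂ ∷ Q) q″)))
  ... | inj₁ q″ with link⁻ {w₁} {w₂} {w₁} {r} q″
  ...   | inj₁ (_ , r≡w₂)  = inj₂ r≡w₂
  ...   | inj₂ (w₁≡w₂ , _) = ⊥-elim (after (here w₁≡w₂))

  closed-interior-neighbours : ∀ z₀ Z P w₀ w₁ w₂ Q r → Unique (z₀ ∷ Z) →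
    closed z₀ Z ≡ P ++ w₀ ∷ w₁ ∷ w₂ ∷ Q →
    consec (closed z₀ Z) w₁ r ≡ true → r ≡ w₀ ⊎ r ≡ w₂
  closed-interior-neighbours z₀ Z P w₀ w₁ w₂ Q r u eq p
    with split-before-last (P ++ w₀ ∷ [ w₁ ]) w₂ Q (z₀ ∷ Z) z₀ (trans (++-assoc P (w₀ ∷ [ w₁ ]) (w₂ ∷ Q)) (sym eq))
  ... | Q₀ , e₁ , e₂ = interior-neighbours P w₀ w₁ w₂ Q r before after (subst (λ t → consec t w₁ r ≡ true) eq p)
    where
    e₃ : z₀ ∷ Z ≡ (P ++ [ w₀ ]) ++ w₁ ∷ Q₀
    e₃ = trans e₂ (trans (++-assoc P (w₀ ∷ [ w₁ ]) Q₀) (sym (++-assoc P [ w₀ ] (w₁ ∷ Q₀))))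
    parts : Unique (P ++ [ w₀ ]) × Unique (w₁ ∷ Q₀) × (P ++ [ w₀ ]) # (w₁ ∷ Q₀)
    parts = Unique-++⁻ (P ++ [ w₀ ]) (subst Unique e₃ u)
    head∈ : ∀ (P : List V) {z Z R} → z ∷ Z ≡ (P ++ [ w₀ ]) ++ R → z ∈ P ++ [ w₀ ]
    head∈ []      refl = here refl
    head∈ (_ ∷ _) refl = here refl
    before : w₁ ∉ P ++ [ w₀ ]
    before m = proj₂ (proj₂ parts) m (here refl)
    after : w₁ ∉ w₂ ∷ Q
    after m with ∈-++⁻ Q₀ (subst (w₁ ∈_) e₁ m)
    ... | inj₁ m′        = Unique.Unique[x∷xs]⇒x∉xs (proj₁ (proj₂ parts)) m′
    ... | inj₂ (here refl) = before (head∈ P e₃)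

  -- Cycles

  DegreeTwoAt : Edges → V → Set
  DegreeTwoAt γ w = ∀ p → γ w p ≡ true →
    Σ V λ q → q ≢ p × γ w q ≡ true × (∀ r → γ w r ≡ true → r ≡ p ⊎ r ≡ q)

  DegreeTwo : Edges → Set
  DegreeTwo γ = ∀ w → DegreeTwoAt γ w

  two-neighbours⇒DegreeTwoAt : ∀ {γ : Edges} {w} k kl → k ≢ kl → γ w k ≡ true → γ w kl ≡ true →
    (∀ r → γ w r ≡ true → r ≡ k ⊎ r ≡ kl) → DegreeTwoAt γ w
  two-neighbours⇒DegreeTwoAt k kl k≢kl gk gkl only p gp with only p gp
  ... | inj₁ refl = kl , (λ e → k≢kl (sym e)) , gkl , only
  ... | inj₂ refl = k , k≢kl , gk , λ r g → [ inj₂ , inj₁ ]′ (only r g)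

  DegreeTwoAt-resp-≐ : ∀ {γ δ : Edges} {w} → γ ≐ δ → DegreeTwoAt γ w → DegreeTwoAt δ w
  DegreeTwoAt-resp-≐ {w = w} γ≐δ deg p g with deg p (trans (γ≐δ w p) g)
  ... | q , q≢p , gq , only = q , q≢p , trans (sym (γ≐δ w q)) gq , λ r g′ → only r (trans (γ≐δ w r) g′)

  InteriorDegreeTwo : Edges → List V → Set
  InteriorDegreeTwo H (w₀ ∷ w₁ ∷ w₂ ∷ l) =
    (∀ r → H w₁ r ≡ true → r ≡ w₀ ⊎ r ≡ w₂) × InteriorDegreeTwo H (w₁ ∷ w₂ ∷ l)
  InteriorDegreeTwo H _ = ⊤

  record CycleIn (H γ : Edges) : Set where
    field
      ⊆H         : γ ⊆ₑ H
      symmetric  : IsSymmetric γ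
      degree-two : DegreeTwo γ
      nonempty   : Σ V λ i → Σ V λ j → γ i j ≡ true

  CycleIn-mono : ∀ {H H′ γ} → H ⊆ₑ H′ → CycleIn H γ → CycleIn H′ γ
  CycleIn-mono H⊆H′ c = record
    { ⊆H = λ i j g → H⊆H′ i j (⊆H i j g) ; symmetric = symmetric ; degree-two = degree-two ; nonempty = nonempty }
    where open CycleIn c

  -- A degree-two subgraph of H meeting a walk whose inner vertices have degree two in H
  -- contains the whole walk.
  module Propagation {γ H : Edges} (γ⊆H : γ ⊆ₑ H) (symγ : IsSymmetric γ) (deg : DegreeTwo γ) where

    spread : ∀ w₀ w₁ l → InteriorDegreeTwo H (w₀ ∷ w₁ ∷ l) → γ w₀ w₁ ≡ true →
             consec (w₀ ∷ w₁ ∷ l) ⊆ₑ γ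
    spread w₀ w₁ l inner g i j c with ∨-true⁻ {link w₀ w₁ i j} c
    spread w₀ w₁ l        inner          g i j c | inj₁ e  = link-⊆ symγ g i j e
    spread w₀ w₁ []       inner          g i j c | inj₂ ()
    spread w₀ w₁ (w₂ ∷ l) (only , inner) g i j c | inj₂ c′ with deg w₁ w₀ (trans (symγ w₁ w₀) g)
    ... | q , q≢w₀ , gq , _ with only q (γ⊆H w₁ q gq)
    ...   | inj₁ q≡w₀ = ⊥-elim (q≢w₀ q≡w₀)
    ...   | inj₂ refl = spread w₁ q l inner gq i j c′

    reach-start : ∀ w₀ w₁ l → InteriorDegreeTwo H (w₀ ∷ w₁ ∷ l) → ∀ i j →
                  consec (w₀ ∷ w₁ ∷ l) i j ≡ true → γ i j ≡ true → γ w₀ w₁ ≡ true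
    reach-start w₀ w₁ l inner i j c g with ∨-true⁻ {link w₀ w₁ i j} c
    reach-start w₀ w₁ l inner i j c g | inj₁ e with link⁻ {w₀} {w₁} {i} {j} e
    ... | inj₁ (refl , refl) = g
    ... | inj₂ (refl , refl) = trans (symγ w₀ w₁) g
    reach-start w₀ w₁ []       inner          i j c g | inj₂ ()
    reach-start w₀ w₁ (w₂ ∷ l) (only , inner) i j c g | inj₂ c′ with deg w₁ w₂ (reach-start w₁ w₂ l inner i j c′ g)
    ... | q , q≢w₂ , gq , _ with only q (γ⊆H w₁ q gq)
    ...   | inj₂ q≡w₂ = ⊥-elim (q≢w₂ q≡w₂)
    ...   | inj₁ refl = trans (symγ w₀ w₁) gq

    all-or-nothing : ∀ l → InteriorDegreeTwo H l → ∀ i j → consec l i j ≡ true → γ i j ≡ true → consec l ⊆ₑ γ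
    all-or-nothing []            _     _ _ ()
    all-or-nothing (_ ∷ [])      _     _ _ ()
    all-or-nothing (w₀ ∷ w₁ ∷ l) inner i j c g = spread w₀ w₁ l inner (reach-start w₀ w₁ l inner i j c g)

  ∪ₑ-false⁻ : ∀ {γ F : Edges} {i j} → F i j ≡ false → (γ ∪ₑ F) i j ≡ true → γ i j ≡ true
  ∪ₑ-false⁻ {γ} {i = i} {j} f h rewrite f = trans (sym (∨-identityʳ (γ i j))) h

  closed-InteriorDegreeTwo : ∀ z₀ Z (F : Edges) → Unique (z₀ ∷ Z) → ∀ P w₀ M wₖ Q →
    closed z₀ Z ≡ P ++ w₀ ∷ M ++ wₖ ∷ Q → (∀ {w} → w ∈ M → ∀ r → F w r ≡ false) →
    InteriorDegreeTwo (consec (closed z₀ Z) ∪ₑ F) (w₀ ∷ M ++ [ wₖ ])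
  closed-InteriorDegreeTwo z₀ Z F u P w₀ []           wₖ Q eq F-off = tt
  closed-InteriorDegreeTwo z₀ Z F u P w₀ (m ∷ [])     wₖ Q eq F-off =
    (λ r h → closed-interior-neighbours z₀ Z P w₀ m wₖ Q r u eq (∪ₑ-false⁻ {consec (closed z₀ Z)} {F} (F-off (here refl) r) h)) , tt
  closed-InteriorDegreeTwo z₀ Z F u P w₀ (m ∷ m′ ∷ M) wₖ Q eq F-off =
    (λ r h → closed-interior-neighbours z₀ Z P w₀ m m′ (M ++ wₖ ∷ Q) r u eq (∪ₑ-false⁻ {consec (closed z₀ Z)} {F} (F-off (here refl) r) h)) ,
    closed-InteriorDegreeTwo z₀ Z F u (P ++ [ w₀ ]) m (m′ ∷ M) wₖ Q
      (trans eq (sym (++-assoc P [ w₀ ] _))) (λ m∈ → F-off (there m∈))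

  CycleIn-closed : ∀ z₀ Z → Unique (z₀ ∷ Z) → ∀ γ → CycleIn (consec (closed z₀ Z)) γ → γ ≐ consec (closed z₀ Z)
  CycleIn-closed z₀ Z u γ c i j = ≡-from-truth (⊆H i j) (all-or-nothing (closed z₀ Z) inner i₀ j₀ (⊆H i₀ j₀ g₀) g₀ i j)
    where
    open CycleIn c
    i₀ j₀ : V
    i₀ = proj₁ nonempty
    j₀ = proj₁ (proj₂ nonempty)
    g₀ : γ i₀ j₀ ≡ true
    g₀ = proj₂ (proj₂ nonempty)
    open Propagation {γ} (λ i j g → ∨-trueˡ false (⊆H i j g)) symmetric degree-two
    inner : InteriorDegreeTwo (consec (closed z₀ Z) ∪ₑ (λ _ _ → false)) (closed z₀ Z)
    inner = closed-InteriorDegreeTwo z₀ Z _ u [] z₀ Z z₀ [] refl (λ _ _ → refl)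

  rotate : ∀ x Z P w Q → x ∷ Z ≡ P ++ w ∷ Q → Unique (x ∷ Z) →
           Unique (w ∷ Q ++ P) × consec (closed x Z) ≐ consec (closed w (Q ++ P))
  rotate x Z []      w Q refl u =
    subst (λ t → Unique (w ∷ t)) (sym (++-identityʳ Q)) u ,
    λ i j → cong (λ t → consec (closed w t) i j) (sym (++-identityʳ Q))
  rotate x Z (p ∷ P) w Q refl u = Unique-swap (x ∷ P) (w ∷ Q) u , consec-rotate x P w Q

  closed-start-DegreeTwoAt : ∀ x Z → Unique (x ∷ Z) → 2 ≤ length Z → DegreeTwoAt (consec (closed x Z)) x
  closed-start-DegreeTwoAt x []           _ ()
  closed-start-DegreeTwoAt x (k ∷ [])     _ (s≤s ())
  closed-start-DegreeTwoAt x (k ∷ k′ ∷ K) (x∉ ∷ k∉ ∷ _) _ with init-last k′ K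
  ... | K₂ , kl , eq = two-neighbours⇒DegreeTwoAt {consec (closed x (k ∷ k′ ∷ K))} {x} k kl k≢kl (∨-trueˡ _ (link-ab x k)) x-kl only
    where
    x∉′ : x ∉ k ∷ k′ ∷ K
    x∉′ = All¬⇒¬Any x∉
    k≢kl : k ≢ kl
    k≢kl e = All¬⇒¬Any k∉ (subst (k ∈_) (sym eq) (∈-++⁺ʳ K₂ (here e)))
    as-closed : closed x (k ∷ k′ ∷ K) ≡ closed x (k ∷ K₂ ++ [ kl ])
    as-closed = cong (λ t → closed x (k ∷ t)) eq
    x-kl : consec (closed x (k ∷ k′ ∷ K)) x kl ≡ true
    x-kl = subst (λ t → consec t x kl ≡ true) (sym as-closed)
      (trans (cong (λ t → consec (x ∷ k ∷ t) x kl) (++-assoc K₂ [ kl ] [ x ]))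
        (trans (consec-++ (x ∷ k ∷ K₂) kl [ x ] x kl)
               (∨-trueʳ (consec (x ∷ k ∷ K₂ ++ [ kl ]) x kl) (∨-trueˡ false (link-ba kl x)))))
    only : ∀ r → consec (closed x (k ∷ k′ ∷ K)) x r ≡ true → r ≡ k ⊎ r ≡ kl
    only r c = closed-start-neighbours x k K₂ kl r (subst (x ∉_) (cong (k ∷_) eq) x∉′)
                 (subst (λ t → consec t x r ≡ true) as-closed c)

  closed-DegreeTwo : ∀ x Z → Unique (x ∷ Z) → 2 ≤ length Z → DegreeTwo (consec (closed x Z))
  closed-DegreeTwo x Z u len w p g = at (proj₁ (consec⇒∈ (closed x Z) g)) p g
    where
    at : w ∈ closed x Z → DegreeTwoAt (consec (closed x Z)) w
    at (here refl) = closed-start-DegreeTwoAt x Z u len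
    at (there m) with ∈-++⁻ Z m
    ... | inj₂ (here refl) = closed-start-DegreeTwoAt x Z u len
    ... | inj₁ w∈Z with ∈-∃++ w∈Z
    ...   | P , Q , refl with rotate x (P ++ w ∷ Q) (x ∷ P) w Q refl u
    ...     | u′ , rotated = DegreeTwoAt-resp-≐ (λ i j → sym (rotated i j))
                               (closed-start-DegreeTwoAt w (Q ++ x ∷ P) u′ (subst (2 ≤_) same-length len))
      where
      same-length : length (P ++ w ∷ Q) ≡ length (Q ++ x ∷ P)
      same-length = suc-injective (↭-length (↭-++-comm (x ∷ P) (w ∷ Q)))

  vec-ext : ∀ {A : Set} {k} (xs ys : Vec A k) → (∀ i → lookup xs i ≡ lookup ys i) → xs ≡ ys
  vec-ext xs ys f = trans (sym (tabulate∘lookup xs)) (trans (tabulate-cong f) (tabulate∘lookup ys))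

  Mat-ext : ∀ (M N : Mat n) → entry M ≐ entry N → M ≡ N
  Mat-ext M N f = vec-ext M N (λ i → vec-ext (lookup M i) (lookup N i) (f i))

  entry-edgesOf : ∀ (p : List V) → entry (edgesOf p) ≐ consec p
  entry-edgesOf p i j = trans (cong (λ r → lookup r j) (lookup∘tabulate _ i)) (lookup∘tabulate _ j)

  entry-Δ : ∀ (F H : Mat n) → entry (F Δ H) ≐ (entry F ⊕ entry H)
  entry-Δ F H i j = trans (cong (λ r → lookup r j) (lookup-zipWith (zipWith _xor_) i F H))
                          (lookup-zipWith _xor_ j (lookup F i) (lookup H i))

  entry-addEdge : ∀ (M : Mat n) a b → entry (addEdge M a b) ≐ (entry M ∪ₑ link a b)
  entry-addEdge M a b i j = trans (cong (λ r → lookup r j) (lookup∘tabulate _ i)) (lookup∘tabulate _ j)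

  walk-head : ∀ {u v h : V} {t} → WalkFromTo u v (h ∷ t) → h ≡ u
  walk-head (one _)  = refl
  walk-head (cons _) = refl

  IsCycle⇒closed : ∀ {G : Graph n} γ → IsCycle G γ →
    Σ V λ x → Σ (List V) λ Z → Unique (x ∷ Z) × 2 ≤ length Z × entry γ ≐ consec (closed x Z)
  IsCycle⇒closed γ (h ∷ Z , x , s≤s len , u , w , _ , refl) with walk-head w
  ... | refl = h , Z , u , len , entry-edgesOf (closed h Z)

  IsCycle⇒CycleIn : ∀ {G : Graph n} γ → IsCycle G γ → ∀ {H} → entry γ ⊆ₑ H → CycleIn H (entry γ)
  IsCycle⇒CycleIn γ cyc {H} γ⊆H with IsCycle⇒closed γ cyc
  ... | x , k ∷ Z , u , len , γ≐ = record
    { ⊆H         = γ⊆H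
    ; symmetric  = λ i j → trans (γ≐ i j) (trans (consec-sym (closed x (k ∷ Z)) i j) (sym (γ≐ j i)))
    ; degree-two = λ w → DegreeTwoAt-resp-≐ (λ i j → sym (γ≐ i j)) (closed-DegreeTwo x (k ∷ Z) u len w)
    ; nonempty   = x , k , trans (γ≐ x k) (∨-trueˡ _ (link-ab x k))
    }

  -- Theta graphs

  addLink : List V → V → V → Edges
  addLink p a b = consec p ∪ₑ link a b

  data TwoOfThree : Bool → Bool → Bool → Set where
    ttf : TwoOfThree true true false
    tft : TwoOfThree true false true
    ftt : TwoOfThree false true true

  module Theta (a m : V) (M′ : List V) (b n : V) (N′ : List V)
               (u : Unique (a ∷ (m ∷ M′) ++ b ∷ n ∷ N′))
               (ab∉rim : consec (closed a ((m ∷ M′) ++ b ∷ n ∷ N′)) a b ≡ false) where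
    M N : List V
    M = m ∷ M′
    N = n ∷ N′

    rim chord arc₁ arc₂ : Edges
    rim   = consec (closed a (M ++ b ∷ N))
    chord = link a b
    arc₁  = consec (a ∷ M ++ [ b ])
    arc₂  = consec (b ∷ N ++ [ a ])

    rim-as-arcs : closed a (M ++ b ∷ N) ≡ (a ∷ M) ++ b ∷ (N ++ [ a ])
    rim-as-arcs = cong (a ∷_) (++-assoc M (b ∷ N) [ a ])

    rim≐arcs : rim ≐ (arc₁ ∪ₑ arc₂)
    rim≐arcs i j = trans (cong (λ t → consec t i j) rim-as-arcs) (consec-++ (a ∷ M) b (N ++ [ a ]) i j)

    a∉ : a ∉ M ++ b ∷ N
    a∉ = Unique.Unique[x∷xs]⇒x∉xs u
    parts : Unique M × Unique (b ∷ N) × M # (b ∷ N)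
    parts = Unique-++⁻ M (AllPairs.tail u)

    a∉M : ∀ {w} → w ∈ M → w ≢ a
    a∉M w∈ refl = a∉ (∈-++⁺ˡ w∈)
    b∉M : ∀ {w} → w ∈ M → w ≢ b
    b∉M w∈ refl = proj₂ (proj₂ parts) w∈ (here refl)
    a∉N : ∀ {w} → w ∈ N → w ≢ a
    a∉N w∈ refl = a∉ (∈-++⁺ʳ M (there w∈))
    b∉N : ∀ {w} → w ∈ N → w ≢ b
    b∉N w∈ refl = Unique.Unique[x∷xs]⇒x∉xs (proj₁ (proj₂ parts)) w∈
    M∩N : ∀ {w} → w ∈ M → w ∉ N
    M∩N w∈M w∈N = proj₂ (proj₂ parts) w∈M (there w∈N)
    a≢b : a ≢ b
    a≢b refl = a∉ (∈-++⁺ʳ M (here refl))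

    N₀ : List V
    N₀ = proj₁ (init-last n N′)
    nl : V
    nl = proj₁ (proj₂ (init-last n N′))
    N≡ : N ≡ N₀ ++ [ nl ]
    N≡ = proj₂ (proj₂ (init-last n N′))
    nl∈N : nl ∈ N
    nl∈N = subst (nl ∈_) (sym N≡) (∈-++⁺ʳ _ (here refl))

    arc₁-am : arc₁ a m ≡ true
    arc₁-am = ∨-trueˡ _ (link-ab a m)

    arc₂-nla : arc₂ nl a ≡ true
    arc₂-nla = subst (λ t → consec t nl a ≡ true) (sym arc₂-as)
      (trans (consec-++ (b ∷ N₀) nl [ a ] nl a) (∨-trueʳ (consec (b ∷ N₀ ++ [ nl ]) nl a) (∨-trueˡ false (link-ab nl a))))
      where
      arc₂-as : b ∷ N ++ [ a ] ≡ (b ∷ N₀) ++ nl ∷ [ a ]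
      arc₂-as = trans (cong (λ t → b ∷ t ++ [ a ]) N≡) (cong (b ∷_) (++-assoc N₀ [ nl ] [ a ]))

    rim-neighbours-of-a : ∀ r → (rim ∪ₑ chord) a r ≡ true → r ≡ m ⊎ r ≡ nl ⊎ r ≡ b
    rim-neighbours-of-a r h with ∨-true⁻ {rim a r} h
    ... | inj₂ q with link⁻ {a} {b} {a} {r} q
    ...   | inj₁ (_ , r≡b) = inj₂ (inj₂ r≡b)
    ...   | inj₂ (a≡b , _) = ⊥-elim (a≢b a≡b)
    rim-neighbours-of-a r h | inj₁ q
      with closed-start-neighbours a m (M′ ++ b ∷ N₀) nl r (subst (a ∉_) as-init-last a∉)
             (subst (λ t → consec (closed a t) a r ≡ true) as-init-last q)
      where
      as-init-last : M ++ b ∷ N ≡ m ∷ (M′ ++ b ∷ N₀) ++ [ nl ]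
      as-init-last = cong (m ∷_) (trans (cong (λ t → M′ ++ b ∷ t) N≡) (sym (++-assoc M′ (b ∷ N₀) [ nl ])))
    ... | inj₁ r≡m  = inj₁ r≡m
    ... | inj₂ r≡nl = inj₂ (inj₁ r≡nl)

    ∉arc₂ : ∀ {w} → w ∈ M → w ∉ b ∷ N ++ [ a ]
    ∉arc₂ w∈ (here e) = b∉M w∈ e
    ∉arc₂ w∈ (there w∈′) with ∈-++⁻ N w∈′
    ... | inj₁ w∈N       = M∩N w∈ w∈N
    ... | inj₂ (here e) = a∉M w∈ e

    arc₁-unique : Unique (a ∷ M ++ [ b ])
    arc₁-unique = Unique-∷⁺ (λ w∈ → [ (λ w∈M → a∉M w∈M refl) , (λ { (here e) → a≢b e }) ]′ (∈-++⁻ M w∈))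
                            (Unique-++⁺ (proj₁ parts) Unique-[ b ] (λ w∈M → λ { (here e) → b∉M w∈M e }))


    arc₁-ab : arc₁ a b ≡ false
    arc₁-ab = ∨-conicalˡ (arc₁ a b) (arc₂ a b) (trans (sym (rim≐arcs a b)) ab∉rim)
    arc₂-ab : arc₂ a b ≡ false
    arc₂-ab = ∨-conicalʳ (arc₁ a b) (arc₂ a b) (trans (sym (rim≐arcs a b)) ab∉rim)

    chord-off : ∀ (R : List V) → consec R a b ≡ false → ∀ i j → consec R i j ≡ true → chord i j ≡ true → ⊥
    chord-off R off i j c e with link⁻ {a} {b} {i} {j} e
    ... | inj₁ (refl , refl) = false≢true (trans (sym off) c)
    ... | inj₂ (refl , refl) = false≢true (trans (sym off) (trans (consec-sym R a b) c))

    arcs-meet-at-ends : ∀ {w} → w ∈ a ∷ M ++ [ b ] → w ∈ b ∷ N ++ [ a ] → w ≡ a ⊎ w ≡ b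
    arcs-meet-at-ends (here e)   _  = inj₁ e
    arcs-meet-at-ends (there w∈) w∈₂ with ∈-++⁻ M w∈
    ... | inj₁ w∈M      = ⊥-elim (∉arc₂ w∈M w∈₂)
    ... | inj₂ (here e) = inj₂ e

    arcs-disjoint : ∀ i j → arc₁ i j ≡ true → arc₂ i j ≡ true → ⊥
    arcs-disjoint i j c₁ c₂ with arcs-meet-at-ends (proj₁ (consec⇒∈ (a ∷ M ++ [ b ]) c₁)) (proj₁ (consec⇒∈ (b ∷ N ++ [ a ]) c₂))
                              | arcs-meet-at-ends (proj₂ (consec⇒∈ (a ∷ M ++ [ b ]) c₁)) (proj₂ (consec⇒∈ (b ∷ N ++ [ a ]) c₂))
    ... | inj₁ refl | inj₁ refl = consec-irrefl (a ∷ M ++ [ b ]) arc₁-unique c₁ refl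
    ... | inj₂ refl | inj₂ refl = consec-irrefl (a ∷ M ++ [ b ]) arc₁-unique c₁ refl
    ... | inj₁ refl | inj₂ refl = false≢true (trans (sym arc₁-ab) c₁)
    ... | inj₂ refl | inj₁ refl = false≢true (trans (sym arc₁-ab) (trans (consec-sym (a ∷ M ++ [ b ]) a b) c₁))

    module InTheta {γ : Edges} (c : CycleIn (rim ∪ₑ chord) γ) where
      open CycleIn c
      open Propagation ⊆H symmetric degree-two

      inner₁ : InteriorDegreeTwo (rim ∪ₑ chord) (a ∷ M ++ [ b ])
      inner₁ = closed-InteriorDegreeTwo a (M ++ b ∷ N) chord u [] a M b (N ++ [ a ]) rim-as-arcs
                 (λ w∈ r → non-endpoint⇒link-false r (a∉M w∈) (b∉M w∈))
      inner₂ : InteriorDegreeTwo (rim ∪ₑ chord) (b ∷ N ++ [ a ])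
      inner₂ = closed-InteriorDegreeTwo a (M ++ b ∷ N) chord u (a ∷ M) b N a [] rim-as-arcs
                 (λ w∈ r → non-endpoint⇒link-false r (a∉N w∈) (b∉N w∈))

      arc₁-all : γ a m ≡ true → arc₁ ⊆ₑ γ
      arc₁-all = all-or-nothing (a ∷ M ++ [ b ]) inner₁ a m arc₁-am
      arc₁-hit : ∀ i j → arc₁ i j ≡ true → γ i j ≡ true → γ a m ≡ true
      arc₁-hit i j c g = all-or-nothing (a ∷ M ++ [ b ]) inner₁ i j c g a m arc₁-am
      arc₂-all : γ a nl ≡ true → arc₂ ⊆ₑ γ
      arc₂-all g = all-or-nothing (b ∷ N ++ [ a ]) inner₂ nl a arc₂-nla (trans (symmetric nl a) g)
      arc₂-hit : ∀ i j → arc₂ i j ≡ true → γ i j ≡ true → γ a nl ≡ true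
      arc₂-hit i j c g = trans (symmetric a nl) (all-or-nothing (b ∷ N ++ [ a ]) inner₂ i j c g nl a arc₂-nla)
      chord-hit : ∀ i j → chord i j ≡ true → γ i j ≡ true → γ a b ≡ true
      chord-hit i j e g with link⁻ {a} {b} {i} {j} e
      ... | inj₁ (refl , refl) = g
      ... | inj₂ (refl , refl) = trans (symmetric a b) g

      -- m and nl are the neighbours of a on the two arcs, so the three bits record which of the
      -- three a–b paths of the theta graph γ uses.
      decomposition : γ ≐ λ i j → (γ a m ∧ arc₁ i j) ∨ ((γ a nl ∧ arc₂ i j) ∨ (γ a b ∧ chord i j))
      decomposition i j = ≡-from-truth to from
        where
        to : γ i j ≡ true → _
        to g with ∨-true⁻ {rim i j} (⊆H i j g)
        ... | inj₂ e = ∨-trueʳ (γ a m ∧ arc₁ i j) (∨-trueʳ (γ a nl ∧ arc₂ i j) (∧-true⁺ (chord-hit i j e g) e))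
        ... | inj₁ r with ∨-true⁻ {arc₁ i j} (trans (sym (rim≐arcs i j)) r)
        ...   | inj₁ c₁ = ∨-trueˡ _ (∧-true⁺ (arc₁-hit i j c₁ g) c₁)
        ...   | inj₂ c₂ = ∨-trueʳ (γ a m ∧ arc₁ i j) (∨-trueˡ _ (∧-true⁺ (arc₂-hit i j c₂ g) c₂))
        from : _ → γ i j ≡ true
        from h with ∨-true⁻ {γ a m ∧ arc₁ i j} h
        ... | inj₁ q = arc₁-all (proj₁ (∧-true⁻ q)) i j (proj₂ (∧-true⁻ q))
        ... | inj₂ h′ with ∨-true⁻ {γ a nl ∧ arc₂ i j} h′
        ...   | inj₁ q = arc₂-all (proj₁ (∧-true⁻ q)) i j (proj₂ (∧-true⁻ q))
        ...   | inj₂ q = link-⊆ symmetric (proj₁ (∧-true⁻ {γ a b} q)) i j (proj₂ (∧-true⁻ {γ a b} q))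

      neighbours-of-a : ∀ r → γ a r ≡ true → r ≡ m ⊎ r ≡ nl ⊎ r ≡ b
      neighbours-of-a r g = rim-neighbours-of-a r (⊆H a r g)

      partner : ∀ p → γ a p ≡ true → Σ V λ q → q ≢ p × γ a q ≡ true × (q ≡ m ⊎ q ≡ nl ⊎ q ≡ b)
      partner p g with degree-two a p g
      ... | q , q≢p , gq , _ = q , q≢p , gq , neighbours-of-a q gq

      clash : ∀ {x} → x ≡ false → x ≡ true → ⊥
      clash f t = false≢true (trans (sym f) t)

      not-only-m : γ a m ≡ true → γ a nl ≡ false → γ a b ≡ false → ⊥
      not-only-m g f₂ f₃ with partner m g
      ... | _ , q≢m , _  , inj₁ q≡m         = q≢m q≡m
      ... | _ , _   , gq , inj₂ (inj₁ refl) = clash f₂ gq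
      ... | _ , _   , gq , inj₂ (inj₂ refl) = clash f₃ gq

      not-only-nl : γ a m ≡ false → γ a nl ≡ true → γ a b ≡ false → ⊥
      not-only-nl f₁ g f₃ with partner nl g
      ... | _ , _    , gq , inj₁ refl        = clash f₁ gq
      ... | _ , q≢nl , _  , inj₂ (inj₁ q≡nl) = q≢nl q≡nl
      ... | _ , _    , gq , inj₂ (inj₂ refl) = clash f₃ gq

      not-only-b : γ a m ≡ false → γ a nl ≡ false → γ a b ≡ true → ⊥
      not-only-b f₁ f₂ g with partner b g
      ... | _ , _   , gq , inj₁ refl        = clash f₁ gq
      ... | _ , _   , gq , inj₂ (inj₁ refl) = clash f₂ gq
      ... | _ , q≢b , _  , inj₂ (inj₂ q≡b)  = q≢b q≡b

      not-all-three : γ a m ≡ true → γ a nl ≡ true → γ a b ≡ true → ⊥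
      not-all-three g₁ g₂ g₃ with degree-two a m g₁
      ... | _ , _ , _ , only with only nl g₂ | only b g₃
      ...   | inj₁ nl≡m | _         = M∩N (here refl) (subst (_∈ N) nl≡m nl∈N)
      ...   | inj₂ _    | inj₁ b≡m  = b∉M (here refl) (sym b≡m)
      ...   | inj₂ nl≡q | inj₂ b≡q  = b∉N nl∈N (trans nl≡q (sym b≡q))

      not-none : γ a m ≡ false → γ a nl ≡ false → γ a b ≡ false → ⊥
      not-none f₁ f₂ f₃ = clash empty (proj₂ (proj₂ nonempty))
        where
        empty : γ (proj₁ nonempty) (proj₁ (proj₂ nonempty)) ≡ false
        empty rewrite decomposition (proj₁ nonempty) (proj₁ (proj₂ nonempty)) | f₁ | f₂ | f₃ = refl

      two-of-three : TwoOfThree (γ a m) (γ a nl) (γ a b)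
      two-of-three with γ a m in e₁ | γ a nl in e₂ | γ a b in e₃
      ... | true  | true  | false = ttf
      ... | true  | false | true  = tft
      ... | false | true  | true  = ftt
      ... | true  | true  | true  = ⊥-elim (not-all-three e₁ e₂ e₃)
      ... | true  | false | false = ⊥-elim (not-only-m e₁ e₂ e₃)
      ... | false | true  | false = ⊥-elim (not-only-nl e₁ e₂ e₃)
      ... | false | false | true  = ⊥-elim (not-only-b e₁ e₂ e₃)
      ... | false | false | false = ⊥-elim (not-none e₁ e₂ e₃)

    two-of-three-pair : ∀ {p₁ p₂ p₃ q₁ q₂ q₃} → TwoOfThree p₁ p₂ p₃ → TwoOfThree q₁ q₂ q₃ →
      p₁ xor q₁ ≡ true → p₂ xor q₂ ≡ true → p₃ xor q₃ ≡ false →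
      (p₁ ≡ true × p₂ ≡ false × p₃ ≡ true × q₁ ≡ false × q₂ ≡ true × q₃ ≡ true) ⊎
      (p₁ ≡ false × p₂ ≡ true × p₃ ≡ true × q₁ ≡ true × q₂ ≡ false × q₃ ≡ true)
    two-of-three-pair tft ftt _  _  _ = inj₁ (refl , refl , refl , refl , refl , refl)
    two-of-three-pair ftt tft _  _  _ = inj₂ (refl , refl , refl , refl , refl , refl)
    two-of-three-pair ttf ttf () _  _
    two-of-three-pair ttf tft () _  _
    two-of-three-pair ttf ftt _  () _
    two-of-three-pair tft ttf () _  _
    two-of-three-pair tft tft () _  _
    two-of-three-pair ftt ttf _  () _
    two-of-three-pair ftt ftt () _  _

    cycle₁ cycle₂ : Edges
    cycle₁ = addLink (a ∷ M ++ [ b ]) a b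
    cycle₂ = addLink (b ∷ N ++ [ a ]) a b

    bits⇒cycle₁ : ∀ {p q r} → p ≡ true → q ≡ false → r ≡ true →
      (λ i j → (p ∧ arc₁ i j) ∨ ((q ∧ arc₂ i j) ∨ (r ∧ chord i j))) ≐ cycle₁
    bits⇒cycle₁ refl refl refl i j = refl

    bits⇒cycle₂ : ∀ {p q r} → p ≡ false → q ≡ true → r ≡ true →
      (λ i j → (p ∧ arc₁ i j) ∨ ((q ∧ arc₂ i j) ∨ (r ∧ chord i j))) ≐ cycle₂
    bits⇒cycle₂ refl refl refl i j = refl

    theta-pair : ∀ {α β} → CycleIn (rim ∪ₑ chord) α → CycleIn (rim ∪ₑ chord) β → rim ≐ (α ⊕ β) →
      (α ≐ cycle₁ × β ≐ cycle₂) ⊎ (α ≐ cycle₂ × β ≐ cycle₁)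
    theta-pair {α} {β} cα cβ rim≐ = conclude
      (two-of-three-pair A.two-of-three B.two-of-three
        (trans (sym (rim≐ a m)) (trans (rim≐arcs a m) (∨-trueˡ _ arc₁-am)))
        (trans (sym (rim≐ a nl)) (trans (rim≐arcs a nl) (∨-trueʳ (arc₁ a nl) (trans (consec-sym (b ∷ N ++ [ a ]) a nl) arc₂-nla))))
        (trans (sym (rim≐ a b)) ab∉rim))
      where
      module A = InTheta cα
      module B = InTheta cβ
      conclude : _ → (α ≐ cycle₁ × β ≐ cycle₂) ⊎ (α ≐ cycle₂ × β ≐ cycle₁)
      conclude (inj₁ (p₁ , p₂ , p₃ , q₁ , q₂ , q₃)) =
        inj₁ ((λ i j → trans (A.decomposition i j) (bits⇒cycle₁ p₁ p₂ p₃ i j)) ,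
              (λ i j → trans (B.decomposition i j) (bits⇒cycle₂ q₁ q₂ q₃ i j)))
      conclude (inj₂ (p₁ , p₂ , p₃ , q₁ , q₂ , q₃)) =
        inj₂ ((λ i j → trans (A.decomposition i j) (bits⇒cycle₂ p₁ p₂ p₃ i j)) ,
              (λ i j → trans (B.decomposition i j) (bits⇒cycle₁ q₁ q₂ q₃ i j)))

    cycle₁≐arc₁⊕chord : cycle₁ ≐ (arc₁ ⊕ chord)
    cycle₁≐arc₁⊕chord i j = ∨≡xor (arc₁ i j) (chord i j) (chord-off (a ∷ M ++ [ b ]) arc₁-ab i j)

    cycle₂≐cycle₁⊕rim : cycle₂ ≐ (cycle₁ ⊕ rim)
    cycle₂≐cycle₁⊕rim i j = trans (∨-xor-disjoint (arc₁ i j) (arc₂ i j) (chord i j) (arcs-disjoint i j)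
                                     (chord-off (a ∷ M ++ [ b ]) arc₁-ab i j) (chord-off (b ∷ N ++ [ a ]) arc₂-ab i j))
                                  (cong (cycle₁ i j xor_) (sym (rim≐arcs i j)))

  chord-arcs-nonempty : ∀ a M b N → consec (closed a (M ++ b ∷ N)) a b ≡ false →
    Σ V λ m → Σ (List V) λ M′ → Σ V λ n → Σ (List V) λ N′ → M ≡ m ∷ M′ × N ≡ n ∷ N′
  chord-arcs-nonempty a []       b N  ab∉rim = ⊥-elim (false≢true (trans (sym ab∉rim) (∨-trueˡ _ (link-ab a b))))
  chord-arcs-nonempty a (m ∷ M′) b [] ab∉rim = ⊥-elim (false≢true (trans (sym ab∉rim) ba∈rim))
    where
    ba∈rim : consec (closed a ((m ∷ M′) ++ [ b ])) a b ≡ true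
    ba∈rim = subst (λ t → consec t a b ≡ true) (cong (a ∷_) (sym (++-assoc (m ∷ M′) [ b ] [ a ])))
      (trans (consec-++ (a ∷ m ∷ M′) b [ a ] a b) (∨-trueʳ (consec (a ∷ m ∷ M′ ++ [ b ]) a b) (∨-trueˡ false (link-ba b a))))
  chord-arcs-nonempty a (m ∷ M′) b (n ∷ N′) _ = m , M′ , n , N′ , refl , refl

  module _ (a : V) (M : List V) (b : V) (N : List V) (u : Unique (a ∷ M ++ b ∷ N))
           (ab∉rim : consec (closed a (M ++ b ∷ N)) a b ≡ false) where

    theta-cycles : ∀ {α β} → CycleIn (consec (closed a (M ++ b ∷ N)) ∪ₑ link a b) α →
      CycleIn (consec (closed a (M ++ b ∷ N)) ∪ₑ link a b) β → consec (closed a (M ++ b ∷ N)) ≐ (α ⊕ β) →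
      (α ≐ addLink (a ∷ M ++ [ b ]) a b × β ≐ addLink (b ∷ N ++ [ a ]) a b) ⊎
      (α ≐ addLink (b ∷ N ++ [ a ]) a b × β ≐ addLink (a ∷ M ++ [ b ]) a b)
    theta-cycles with chord-arcs-nonempty a M b N ab∉rim
    ... | m , M′ , n , N′ , refl , refl = Theta.theta-pair a m M′ b n N′ u ab∉rim

    first-cycle≐arc⊕chord : addLink (a ∷ M ++ [ b ]) a b ≐ (consec (a ∷ M ++ [ b ]) ⊕ link a b)
    first-cycle≐arc⊕chord with chord-arcs-nonempty a M b N ab∉rim
    ... | m , M′ , n , N′ , refl , refl = Theta.cycle₁≐arc₁⊕chord a m M′ b n N′ u ab∉rim

    second-cycle≐first⊕rim : addLink (b ∷ N ++ [ a ]) a b ≐ (addLink (a ∷ M ++ [ b ]) a b ⊕ consec (closed a (M ++ b ∷ N)))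
    second-cycle≐first⊕rim with chord-arcs-nonempty a M b N ab∉rim
    ... | m , M′ , n , N′ , refl , refl = Theta.cycle₂≐cycle₁⊕rim a m M′ b n N′ u ab∉rim

  pendant-chord : ∀ x Z → Unique (x ∷ Z) → ∀ a b → a ∉ x ∷ Z → a ≢ b → ∀ γ →
    CycleIn (consec (closed x Z) ∪ₑ link a b) γ → γ ≐ consec (closed x Z)
  pendant-chord x Z u a b a∉ a≢b γ c = CycleIn-closed x Z u γ (record
    { ⊆H = off-chord ; symmetric = symmetric ; degree-two = degree-two ; nonempty = nonempty })
    where
    open CycleIn c
    a∉rim : a ∉ closed x Z
    a∉rim (here e) = a∉ (here e)
    a∉rim (there a∈) with ∈-++⁻ Z a∈
    ... | inj₁ a∈Z      = a∉ (there a∈Z)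
    ... | inj₂ (here e) = a∉ (here e)
    ab∉γ : γ a b ≡ true → ⊥
    ab∉γ g with degree-two a b g
    ... | q , q≢b , gq , _ with ∨-true⁻ {consec (closed x Z) a q} (⊆H a q gq)
    ...   | inj₁ c′ = a∉rim (proj₁ (consec⇒∈ (closed x Z) c′))
    ...   | inj₂ e with link⁻ {a} {b} {a} {q} e
    ...     | inj₁ (_ , q≡b) = q≢b q≡b
    ...     | inj₂ (a≡b , _) = a≢b a≡b
    off-chord : γ ⊆ₑ consec (closed x Z)
    off-chord i j g with ∨-true⁻ {consec (closed x Z) i j} (⊆H i j g)
    ... | inj₁ c′ = c′
    ... | inj₂ e with link⁻ {a} {b} {i} {j} e
    ...   | inj₁ (refl , refl) = ⊥-elim (ab∉γ g)
    ...   | inj₂ (refl , refl) = ⊥-elim (ab∉γ (trans (symmetric a b) g))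

  pendant-chord-impossible : ∀ x Z → Unique (x ∷ Z) → ∀ a b → a ∉ x ∷ Z → a ≢ b → ∀ {α β} →
    CycleIn (consec (closed x Z) ∪ₑ link a b) α → CycleIn (consec (closed x Z) ∪ₑ link a b) β →
    consec (closed x Z) ≐ (α ⊕ β) → ⊥
  pendant-chord-impossible x Z u a b a∉ a≢b {α} {β} cα cβ rim≐ = false≢true (trans (sym rim-off) rim-on)
    where
    open CycleIn cα using (nonempty)
    i₀ j₀ : V
    i₀ = proj₁ nonempty
    j₀ = proj₁ (proj₂ nonempty)
    α≐ : α ≐ consec (closed x Z)
    α≐ = pendant-chord x Z u a b a∉ a≢b α cα
    β≐ : β ≐ consec (closed x Z)
    β≐ = pendant-chord x Z u a b a∉ a≢b β cβ
    rim-on : consec (closed x Z) i₀ j₀ ≡ true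
    rim-on = trans (sym (α≐ i₀ j₀)) (proj₂ (proj₂ nonempty))
    rim-off : consec (closed x Z) i₀ j₀ ≡ false
    rim-off = trans (rim≐ i₀ j₀) (trans (cong₂ _xor_ (α≐ i₀ j₀) (β≐ i₀ j₀)) (xor-same (consec (closed x Z) i₀ j₀)))

  -- Replacing a segment of a path

  Edge⇒≢ : ∀ (G : Graph n) {a b} → Edge G a b → a ≢ b
  Edge⇒≢ G {a} e refl = false≢true (trans (sym (irrefl G a)) e)

  walk-suffix : ∀ {u v} (A : List V) y B → WalkFromTo u v (A ++ y ∷ B) → WalkFromTo y v (y ∷ B)
  walk-suffix []           y B w with walk-head w
  ... | refl = w
  walk-suffix (a ∷ [])     y B (cons w) = walk-suffix [] y B w
  walk-suffix (a ∷ a′ ∷ A) y B (cons w) = walk-suffix (a′ ∷ A) y B w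

  walk-prefix : ∀ (u : V) A y B {v} → WalkFromTo y v (y ∷ B) → WalkFromTo u v (u ∷ A ++ y ∷ B)
  walk-prefix u []       y B w = cons w
  walk-prefix u (a ∷ A) y B w = cons (walk-prefix a A y B w)

  walk-splice : ∀ {u v : V} A x X X′ y B → WalkFromTo u v (A ++ x ∷ X ++ y ∷ B) →
                WalkFromTo u v (A ++ x ∷ X′ ++ y ∷ B)
  walk-splice {u} {v} A x X X′ y B w = go A w
    where
    from-y : WalkFromTo y v (y ∷ B)
    from-y = walk-suffix (A ++ x ∷ X) y B (subst (WalkFromTo u v) (sym (++-assoc A (x ∷ X) (y ∷ B))) w)
    go : ∀ A → WalkFromTo u v (A ++ x ∷ X ++ y ∷ B) → WalkFromTo u v (A ++ x ∷ X′ ++ y ∷ B)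
    go []      w with walk-head w
    ... | refl = walk-prefix x X′ y B from-y
    go (a ∷ A) w with walk-head w
    ... | refl = subst (WalkFromTo a v) (cong (a ∷_) (++-assoc A (x ∷ X′) (y ∷ B))) (walk-prefix a (A ++ x ∷ X′) y B from-y)

  Chain-++⁻ : ∀ {G : Graph n} (l₁ : List V) z l₂ → Chain G (l₁ ++ z ∷ l₂) → Chain G (l₁ ++ [ z ]) × Chain G (z ∷ l₂)
  Chain-++⁻ []           z l₂ c          = single z , c
  Chain-++⁻ (a ∷ [])     z l₂ (step e c) = step e (single z) , c
  Chain-++⁻ (a ∷ b ∷ l₁) z l₂ (step e c) = map₁ (step e) (Chain-++⁻ (b ∷ l₁) z l₂ c)

  Chain-++⁺ : ∀ {G : Graph n} (l₁ : List V) z l₂ → Chain G (l₁ ++ [ z ]) → Chain G (z ∷ l₂) → Chain G (l₁ ++ z ∷ l₂)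
  Chain-++⁺ []           z l₂ _           c = c
  Chain-++⁺ (a ∷ [])     z l₂ (step e _)  c = step e c
  Chain-++⁺ (a ∷ b ∷ l₁) z l₂ (step e c₁) c = step e (Chain-++⁺ (b ∷ l₁) z l₂ c₁ c)

  Chain-splice : ∀ {G : Graph n} A x X X′ y B → Chain G (A ++ x ∷ X ++ y ∷ B) → Chain G (x ∷ X′ ++ [ y ]) →
                 Chain G (A ++ x ∷ X′ ++ y ∷ B)
  Chain-splice A x X X′ y B c c′ with Chain-++⁻ A x (X ++ y ∷ B) c
  ... | cA , cR = Chain-++⁺ A x (X′ ++ y ∷ B) cA (Chain-++⁺ (x ∷ X′) y B c′ (proj₂ (Chain-++⁻ (x ∷ X) y B cR)))

  Unique-segment : ∀ A x X y B → Unique (A ++ x ∷ X ++ y ∷ B) → Unique (x ∷ X ++ [ y ])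
  Unique-segment A x X y B u =
    proj₁ (Unique-++⁻ (x ∷ X ++ [ y ]) (subst Unique (cong (x ∷_) (sym (++-assoc X [ y ] B))) (proj₁ (proj₂ (Unique-++⁻ A u)))))

  Unique-splice : ∀ A x X X′ y B → Unique (A ++ x ∷ X ++ y ∷ B) → Unique (x ∷ X′ ++ [ y ]) →
    X′ # A → X′ # B → Unique (A ++ x ∷ X′ ++ y ∷ B)
  Unique-splice A x X X′ y B u u′ X′∉A X′∉B = Unique-++⁺ uA unique-rest A∉rest
    where
    partsA : Unique A × Unique (x ∷ X ++ y ∷ B) × A # (x ∷ X ++ y ∷ B)
    partsA = Unique-++⁻ A u
    uA : Unique A
    uA = proj₁ partsA
    A∉old : A # (x ∷ X ++ y ∷ B)
    A∉old = proj₂ (proj₂ partsA)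
    partsB : Unique (x ∷ X ++ [ y ]) × Unique B × (x ∷ X ++ [ y ]) # B
    partsB = Unique-++⁻ (x ∷ X ++ [ y ]) (subst Unique (sym (cong (x ∷_) (++-assoc X [ y ] B))) (proj₁ (proj₂ partsA)))
    old∉B : (x ∷ X ++ [ y ]) # B
    old∉B = proj₂ (proj₂ partsB)
    new∉B : (x ∷ X′ ++ [ y ]) # B
    new∉B (here refl) = old∉B (here refl)
    new∉B (there z∈) with ∈-++⁻ X′ z∈
    ... | inj₁ z∈X′       = X′∉B z∈X′
    ... | inj₂ (here refl) = old∉B (there (∈-++⁺ʳ X (here refl)))
    unique-rest : Unique (x ∷ X′ ++ y ∷ B)
    unique-rest = subst Unique (cong (x ∷_) (++-assoc X′ [ y ] B)) (Unique-++⁺ u′ (proj₁ (proj₂ partsB)) new∉B)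
    A∉rest : A # (x ∷ X′ ++ y ∷ B)
    A∉rest z∈A (here refl) = A∉old z∈A (here refl)
    A∉rest z∈A (there z∈) with ∈-++⁻ X′ z∈
    ... | inj₁ z∈X′            = X′∉A z∈X′ z∈A
    ... | inj₂ (here refl)     = A∉old z∈A (there (∈-++⁺ʳ X (here refl)))
    ... | inj₂ (there z∈B)     = A∉old z∈A (there (∈-++⁺ʳ X (there z∈B)))

  IsPath-splice : ∀ {G : Graph n} {u v} A x X X′ y B → IsPath G u v (A ++ x ∷ X ++ y ∷ B) →
    Chain G (x ∷ X′ ++ [ y ]) → Unique (x ∷ X′ ++ [ y ]) →
    X′ # A → X′ # B → IsPath G u v (A ++ x ∷ X′ ++ y ∷ B)
  IsPath-splice A x X X′ y B (w , c , u) c′ u′ X′∉A X′∉B =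
    walk-splice A x X X′ y B w , Chain-splice A x X X′ y B c c′ , Unique-splice A x X X′ y B u u′ X′∉A X′∉B

  consec-segment : ∀ A x X y B → Unique (A ++ x ∷ X ++ y ∷ B) →
    consec (A ++ x ∷ X ++ y ∷ B) ≐ (consec (A ++ [ x ]) ⊕ (consec (x ∷ X ++ [ y ]) ⊕ consec (y ∷ B)))
  consec-segment A x X y B u i j = trans (consec-++-xor A x (X ++ y ∷ B) u i j)
    (cong (consec (A ++ [ x ]) i j xor_) (consec-++-xor (x ∷ X) y B (proj₁ (proj₂ (Unique-++⁻ A u))) i j))

  replacement-sum : ∀ A x X Y y B → Unique (A ++ x ∷ X ++ y ∷ B) → Unique (A ++ x ∷ Y ++ y ∷ B) →
    (consec (A ++ x ∷ X ++ y ∷ B) ⊕ consec (A ++ x ∷ Y ++ y ∷ B)) ≐ (consec (x ∷ X ++ [ y ]) ⊕ consec (x ∷ Y ++ [ y ]))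
  replacement-sum A x X Y y B u₁ u₂ i j
    rewrite consec-segment A x X y B u₁ i j | consec-segment A x Y y B u₂ i j =
    xor-cancel-outer (consec (A ++ [ x ]) i j) (consec (x ∷ X ++ [ y ]) i j) (consec (y ∷ B) i j) (consec (x ∷ Y ++ [ y ]) i j)

  direct⇒empty : ∀ x (X : List V) y → Unique (x ∷ X ++ [ y ]) → consec (x ∷ X ++ [ y ]) x y ≡ true → X ≡ []
  direct⇒empty x []       y u c = refl
  direct⇒empty x (w ∷ X) y (x∉ ∷ w∉ ∷ _) c with ∨-true⁻ {link x w x y} c
  ... | inj₂ c′ = ⊥-elim (All¬⇒¬Any x∉ (proj₁ (consec⇒∈ (w ∷ X ++ [ y ]) c′)))
  ... | inj₁ e with link⁻ {x} {w} {x} {y} e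
  ...   | inj₁ (_ , refl) = ⊥-elim (All¬⇒¬Any w∉ (∈-++⁺ʳ X (here refl)))
  ...   | inj₂ (refl , _) = ⊥-elim (All¬⇒¬Any x∉ (here refl))

  segments-meet-at-ends : ∀ x (X Y : List V) y → X # Y → ∀ {z} → z ∈ x ∷ X ++ [ y ] → z ∈ x ∷ Y ++ [ y ] →
    z ≡ x ⊎ z ≡ y
  segments-meet-at-ends x X Y y disj (here e) _ = inj₁ e
  segments-meet-at-ends x X Y y disj (there z∈) z∈₂ with ∈-++⁻ X z∈
  ... | inj₂ (here e) = inj₂ e
  ... | inj₁ z∈X with z∈₂
  ...   | here e = inj₁ e
  ...   | there z∈′ with ∈-++⁻ Y z∈′
  ...     | inj₁ z∈Y      = ⊥-elim (disj z∈X z∈Y)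
  ...     | inj₂ (here e) = inj₂ e

  closed-sum : ∀ x (X Y : List V) y → Unique (x ∷ X ++ [ y ]) → Unique (x ∷ Y ++ [ y ]) → X # Y →
    ¬ (X ≡ [] × Y ≡ []) → (consec (x ∷ X ++ [ y ]) ⊕ consec (x ∷ Y ++ [ y ])) ≐ consec (closed x (X ++ y ∷ reverse Y))
  closed-sum x X Y y u₁ u₂ disj not-both-direct i j = sym (begin
    consec (closed x (X ++ y ∷ reverse Y)) i j
      ≡⟨ cong (λ t → consec (x ∷ t) i j) (++-assoc X (y ∷ reverse Y) [ x ]) ⟩
    consec ((x ∷ X) ++ y ∷ (reverse Y ++ [ x ])) i j
      ≡⟨ consec-++ (x ∷ X) y (reverse Y ++ [ x ]) i j ⟩
    consec P₁ i j ∨ consec (y ∷ reverse Y ++ [ x ]) i j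
      ≡⟨ cong (consec P₁ i j ∨_) back ⟩
    consec P₁ i j ∨ consec P₂ i j
      ≡⟨ ∨≡xor _ _ edge-disjoint ⟩
    consec P₁ i j xor consec P₂ i j ∎)
    where
    open ≡-Reasoning
    P₁ P₂ : List V
    P₁ = x ∷ X ++ [ y ]
    P₂ = x ∷ Y ++ [ y ]
    back : consec (y ∷ reverse Y ++ [ x ]) i j ≡ consec P₂ i j
    back = begin
      consec (y ∷ reverse Y ++ [ x ]) i j      ≡⟨ cong (λ t → consec (y ∷ t) i j) (sym (unfold-reverse x Y)) ⟩
      consec (y ∷ reverse (x ∷ Y)) i j         ≡⟨ cong (λ t → consec t i j) (sym (reverse-++ (x ∷ Y) [ y ])) ⟩
      consec (reverse P₂) i j                  ≡⟨ consec-reverse P₂ i j ⟩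
      consec P₂ i j                            ∎
    both-direct : consec P₁ x y ≡ true → consec P₂ x y ≡ true → ⊥
    both-direct c₁ c₂ = not-both-direct (direct⇒empty x X y u₁ c₁ , direct⇒empty x Y y u₂ c₂)
    edge-disjoint : consec P₁ i j ≡ true → consec P₂ i j ≡ true → ⊥
    edge-disjoint c₁ c₂ with segments-meet-at-ends x X Y y disj (proj₁ (consec⇒∈ P₁ c₁)) (proj₁ (consec⇒∈ P₂ c₂))
                           | segments-meet-at-ends x X Y y disj (proj₂ (consec⇒∈ P₁ c₁)) (proj₂ (consec⇒∈ P₂ c₂))
    ... | inj₁ refl | inj₁ refl = consec-irrefl P₁ u₁ c₁ refl
    ... | inj₂ refl | inj₂ refl = consec-irrefl P₁ u₁ c₁ refl
    ... | inj₁ refl | inj₂ refl = both-direct c₁ c₂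
    ... | inj₂ refl | inj₁ refl = both-direct (trans (consec-sym P₁ x y) c₁) (trans (consec-sym P₂ x y) c₂)

  replacement-cycle : ∀ A x (X Y : List V) y B → Unique (A ++ x ∷ X ++ y ∷ B) → Unique (A ++ x ∷ Y ++ y ∷ B) →
    X # Y → A ++ x ∷ X ++ y ∷ B ≢ A ++ x ∷ Y ++ y ∷ B →
    Unique (x ∷ X ++ y ∷ reverse Y) ×
    (consec (A ++ x ∷ X ++ y ∷ B) ⊕ consec (A ++ x ∷ Y ++ y ∷ B)) ≐ consec (closed x (X ++ y ∷ reverse Y))
  replacement-cycle A x X Y y B u₁ u₂ disj S≢T =
    unique , λ i j → trans (replacement-sum A x X Y y B u₁ u₂ i j) (closed-sum x X Y y s₁ s₂ disj not-both-direct i j)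
    where
    s₁ : Unique (x ∷ X ++ [ y ])
    s₁ = Unique-segment A x X y B u₁
    s₂ : Unique (x ∷ Y ++ [ y ])
    s₂ = Unique-segment A x Y y B u₂
    not-both-direct : ¬ (X ≡ [] × Y ≡ [])
    not-both-direct (refl , refl) = S≢T refl
    partsY : Unique Y × Unique [ y ] × Y # [ y ]
    partsY = Unique-++⁻ Y (AllPairs.tail s₂)
    P₁∉reverseY : (x ∷ X ++ [ y ]) # reverse Y
    P₁∉reverseY (here refl) z∈ = Unique.Unique[x∷xs]⇒x∉xs s₂ (∈-++⁺ˡ {ys = [ y ]} (Any.reverse⁻ z∈))
    P₁∉reverseY (there z∈)  z∈′ with ∈-++⁻ X z∈
    ... | inj₁ z∈X         = disj z∈X (Any.reverse⁻ z∈′)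
    ... | inj₂ (here refl) = proj₂ (proj₂ partsY) (Any.reverse⁻ z∈′) (here refl)
    unique : Unique (x ∷ X ++ y ∷ reverse Y)
    unique = subst Unique (cong (x ∷_) (++-assoc X [ y ] (reverse Y)))
               (Unique-++⁺ s₁ (Unique-reverse Y (proj₁ partsY)) P₁∉reverseY)

  IsCycle⇒⊆G : ∀ {G : Graph n} γ → IsCycle G γ → γ ⊆ᴱ adj G
  IsCycle⇒⊆G γ (c , x , _ , _ , _ , chain , refl) i j p = Chain⇒Edge (c ++ [ x ]) chain (trans (sym (entry-edgesOf (c ++ [ x ]) i j)) p)

  IsCycle⇒IsUnicycle : ∀ {G : Graph n} γ → IsCycle G γ → IsUnicycle G γ
  IsCycle⇒IsUnicycle γ cyc = (CycleIn.symmetric γ-in-γ , IsCycle⇒⊆G γ cyc) , γ , (cyc , λ _ _ p → p) , only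
    where
    γ-in-γ : CycleIn (entry γ) (entry γ)
    γ-in-γ = IsCycle⇒CycleIn γ cyc (λ _ _ p → p)
    only : ∀ γ′ → IsCycle _ γ′ → γ′ ⊆ᴱ γ → γ′ ≡ γ
    only γ′ cyc′ γ′⊆γ with IsCycle⇒closed γ cyc
    ... | x , Z , u , _ , γ≐ = Mat-ext γ′ γ λ i j →
      trans (CycleIn-closed x Z u (entry γ′) (IsCycle⇒CycleIn γ′ cyc′ (λ i j p → trans (sym (γ≐ i j)) (γ′⊆γ i j p))) i j)
            (sym (γ≐ i j))

  cut-keeps-ends : ∀ x (X : List V) y P a Mi b Q → x ∷ X ++ [ y ] ≡ P ++ a ∷ Mi ++ b ∷ Q →
    Σ (List V) λ X′ → x ∷ X′ ++ [ y ] ≡ P ++ a ∷ b ∷ Q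
  cut-keeps-ends x X y [] a Mi b Q eq with ∷-injective eq
  ... | refl , eq′ with split-before-last Mi b Q X y (sym eq′)
  ...   | Q₀ , e₁ , _ = Q₀ , cong (a ∷_) (sym e₁)
  cut-keeps-ends x X y (p ∷ P) a Mi b Q eq with ∷-injective eq
  ... | refl , eq′ with split-before-last (P ++ a ∷ Mi) b Q X y (trans (++-assoc P (a ∷ Mi) (b ∷ Q)) (sym eq′))
  ...   | Q₀ , e₁ , _ = P ++ a ∷ Q₀ , cong (x ∷_) (trans (++-assoc P (a ∷ Q₀) [ y ]) (cong (λ t → P ++ a ∷ t) (sym e₁)))

  ∈-uncut : ∀ {z : V} P a Mi b Q → z ∈ P ++ a ∷ b ∷ Q → z ∈ P ++ a ∷ Mi ++ b ∷ Q
  ∈-uncut P a Mi b Q z∈ with ∈-++⁻ P z∈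
  ... | inj₁ z∈P                 = ∈-++⁺ˡ z∈P
  ... | inj₂ (here e)            = ∈-++⁺ʳ P (here e)
  ... | inj₂ (there (here e))    = ∈-++⁺ʳ P (there (∈-++⁺ʳ Mi (here e)))
  ... | inj₂ (there (there z∈Q)) = ∈-++⁺ʳ P (there (∈-++⁺ʳ Mi (there z∈Q)))

  two-members-split : ∀ {a b : V} (l : List V) → a ∈ l → b ∈ l → a ≢ b →
    (Σ (List V) λ P → Σ (List V) λ Mi → Σ (List V) λ Q → l ≡ P ++ a ∷ Mi ++ b ∷ Q) ⊎
    (Σ (List V) λ P → Σ (List V) λ Mi → Σ (List V) λ Q → l ≡ P ++ b ∷ Mi ++ a ∷ Q)
  two-members-split (c ∷ l) (here refl) (here refl) a≢b = ⊥-elim (a≢b refl)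
  two-members-split (c ∷ l) (here refl) (there b∈) _ with ∈-∃++ b∈
  ... | Mi , Q , refl = inj₁ ([] , Mi , Q , refl)
  two-members-split (c ∷ l) (there a∈) (here refl) _ with ∈-∃++ a∈
  ... | Mi , Q , refl = inj₂ ([] , Mi , Q , refl)
  two-members-split (c ∷ l) (there a∈) (there b∈) a≢b with two-members-split l a∈ b∈ a≢b
  ... | inj₁ (P , Mi , Q , eq) = inj₁ (c ∷ P , Mi , Q , cong (c ∷_) eq)
  ... | inj₂ (P , Mi , Q , eq) = inj₂ (c ∷ P , Mi , Q , cong (c ∷_) eq)

  ∈-interior : ∀ x (X : List V) y Y {c} → c ∈ x ∷ X ++ [ y ] → c ∉ x ∷ Y ++ [ y ] → c ∈ X
  ∈-interior x X y Y (here refl) c∉ = ⊥-elim (c∉ (here refl))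
  ∈-interior x X y Y (there c∈) c∉ with ∈-++⁻ X c∈
  ... | inj₁ c∈X         = c∈X
  ... | inj₂ (here refl) = ⊥-elim (c∉ (there (∈-++⁺ʳ Y (here refl))))

  consec-via-reverse : ∀ a (X Y : List V) y b → Unique (a ∷ (X ++ y ∷ reverse Y) ++ [ b ]) →
    consec (a ∷ (X ++ y ∷ reverse Y) ++ [ b ]) ≐ (consec (a ∷ X ++ [ y ]) ⊕ consec (b ∷ Y ++ [ y ]))
  consec-via-reverse a X Y y b u i j = begin
    consec (a ∷ (X ++ y ∷ reverse Y) ++ [ b ]) i j
      ≡⟨ cong (λ t → consec (a ∷ t) i j) (++-assoc X (y ∷ reverse Y) [ b ]) ⟩
    consec ((a ∷ X) ++ y ∷ reverse Y ++ [ b ]) i j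
      ≡⟨ consec-++-xor (a ∷ X) y (reverse Y ++ [ b ]) (subst (λ t → Unique (a ∷ t)) (++-assoc X (y ∷ reverse Y) [ b ]) u) i j ⟩
    consec (a ∷ X ++ [ y ]) i j xor consec (y ∷ reverse Y ++ [ b ]) i j
      ≡⟨ cong (λ t → consec (a ∷ X ++ [ y ]) i j xor consec (y ∷ t) i j) (sym (unfold-reverse b Y)) ⟩
    consec (a ∷ X ++ [ y ]) i j xor consec (y ∷ reverse (b ∷ Y)) i j
      ≡⟨ cong (λ t → consec (a ∷ X ++ [ y ]) i j xor consec t i j) (sym (reverse-++ (b ∷ Y) [ y ])) ⟩
    consec (a ∷ X ++ [ y ]) i j xor consec (reverse (b ∷ Y ++ [ y ])) i j
      ≡⟨ cong (consec (a ∷ X ++ [ y ]) i j xor_) (consec-reverse (b ∷ Y ++ [ y ]) i j) ⟩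
    consec (a ∷ X ++ [ y ]) i j xor consec (b ∷ Y ++ [ y ]) i j ∎
    where open ≡-Reasoning

  crossing-rim : ∀ x X₁ a X₂ y Y₁ b (Y₂ : List V) →
    x ∷ (X₁ ++ a ∷ X₂) ++ y ∷ reverse (Y₁ ++ b ∷ Y₂) ≡ (x ∷ X₁) ++ a ∷ (X₂ ++ y ∷ reverse Y₂) ++ b ∷ reverse Y₁
  crossing-rim x X₁ a X₂ y Y₁ b Y₂ = cong (x ∷_) (begin
    (X₁ ++ a ∷ X₂) ++ y ∷ reverse (Y₁ ++ b ∷ Y₂)     ≡⟨ ++-assoc X₁ (a ∷ X₂) _ ⟩
    X₁ ++ a ∷ X₂ ++ y ∷ reverse (Y₁ ++ b ∷ Y₂)       ≡⟨ cong (λ t → X₁ ++ a ∷ X₂ ++ y ∷ t) reversed ⟩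
    X₁ ++ a ∷ X₂ ++ y ∷ reverse Y₂ ++ b ∷ reverse Y₁ ≡⟨ cong (λ t → X₁ ++ a ∷ t) (sym (++-assoc X₂ (y ∷ reverse Y₂) _)) ⟩
    X₁ ++ a ∷ (X₂ ++ y ∷ reverse Y₂) ++ b ∷ reverse Y₁ ∎)
    where
    open ≡-Reasoning
    reversed : reverse (Y₁ ++ b ∷ Y₂) ≡ reverse Y₂ ++ b ∷ reverse Y₁
    reversed = trans (reverse-++ Y₁ (b ∷ Y₂))
                     (trans (cong (_++ reverse Y₁) (unfold-reverse b Y₂)) (++-assoc (reverse Y₂) [ b ] (reverse Y₁)))

  crossing-sum : ∀ A a (X : List V) y B b Y → Unique (A ++ a ∷ X ++ y ∷ B) → Unique (A ++ a ∷ (b ∷ Y) ++ y ∷ B) →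
    Unique (a ∷ (X ++ y ∷ reverse Y) ++ [ b ]) →
    (consec (A ++ a ∷ X ++ y ∷ B) ⊕ consec (A ++ a ∷ (b ∷ Y) ++ y ∷ B)) ≐ (consec (a ∷ (X ++ y ∷ reverse Y) ++ [ b ]) ⊕ link a b)
  crossing-sum A a X y B b Y u₁ u₂ u-arc i j = begin
    consec (A ++ a ∷ X ++ y ∷ B) i j xor consec (A ++ a ∷ (b ∷ Y) ++ y ∷ B) i j
      ≡⟨ replacement-sum A a X (b ∷ Y) y B u₁ u₂ i j ⟩
    consec (a ∷ X ++ [ y ]) i j xor consec (a ∷ b ∷ Y ++ [ y ]) i j
      ≡⟨ cong (consec (a ∷ X ++ [ y ]) i j xor_) (consec-++-xor [ a ] b (Y ++ [ y ]) (Unique-segment A a (b ∷ Y) y B u₂) i j) ⟩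
    consec (a ∷ X ++ [ y ]) i j xor ((link a b i j ∨ false) xor consec (b ∷ Y ++ [ y ]) i j)
      ≡⟨ xor-regroup (consec (a ∷ X ++ [ y ]) i j) (link a b i j) (consec (b ∷ Y ++ [ y ]) i j) ⟩
    (consec (a ∷ X ++ [ y ]) i j xor consec (b ∷ Y ++ [ y ]) i j) xor link a b i j
      ≡⟨ cong (_xor link a b i j) (sym (consec-via-reverse a X Y y b u-arc i j)) ⟩
    consec (a ∷ (X ++ y ∷ reverse Y) ++ [ b ]) i j xor link a b i j ∎
    where open ≡-Reasoning

  crossing-IsPath : ∀ {G : Graph n} {u v} A B x y X₁ a X₂ Y₁ b Y₂ →
    IsPath G u v (A ++ x ∷ (X₁ ++ a ∷ X₂) ++ y ∷ B) → IsPath G u v (A ++ x ∷ (Y₁ ++ b ∷ Y₂) ++ y ∷ B) →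
    (∀ z → z ∈ X₁ ++ a ∷ X₂ → z ∉ Y₁ ++ b ∷ Y₂) → Edge G a b →
    IsPath G u v ((A ++ x ∷ X₁) ++ a ∷ (b ∷ Y₂) ++ y ∷ B)
  crossing-IsPath {G} {u} {v} A B x y X₁ a X₂ Y₁ b Y₂ ps pt disj ab∈G =
    IsPath-splice (A ++ x ∷ X₁) a X₂ (b ∷ Y₂) y B (subst (IsPath G u v) S≡ ps) new-chain new-unique bY₂∉A′ bY₂∉B
    where
    S≡ : A ++ x ∷ (X₁ ++ a ∷ X₂) ++ y ∷ B ≡ (A ++ x ∷ X₁) ++ a ∷ X₂ ++ y ∷ B
    S≡ = trans (cong (λ t → A ++ x ∷ t) (++-assoc X₁ (a ∷ X₂) (y ∷ B))) (sym (++-assoc A (x ∷ X₁) _))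
    T≡ : A ++ x ∷ (Y₁ ++ b ∷ Y₂) ++ y ∷ B ≡ (A ++ x ∷ Y₁) ++ b ∷ Y₂ ++ y ∷ B
    T≡ = trans (cong (λ t → A ++ x ∷ t) (++-assoc Y₁ (b ∷ Y₂) (y ∷ B))) (sym (++-assoc A (x ∷ Y₁) _))
    uT : Unique (A ++ x ∷ (Y₁ ++ b ∷ Y₂) ++ y ∷ B)
    uT = proj₂ (proj₂ pt)
    a∈X : a ∈ X₁ ++ a ∷ X₂
    a∈X = ∈-++⁺ʳ X₁ (here refl)
    bY₂⊆Y : ∀ {z} → z ∈ b ∷ Y₂ → z ∈ Y₁ ++ b ∷ Y₂
    bY₂⊆Y = ∈-++⁺ʳ Y₁
    new-unique : Unique (a ∷ (b ∷ Y₂) ++ [ y ])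
    new-unique = Unique-∷⁺ a∉ (Unique-segment (A ++ x ∷ Y₁) b Y₂ y B (subst Unique T≡ uT))
      where
      a∉ : a ∉ b ∷ Y₂ ++ [ y ]
      a∉ (here e) = Edge⇒≢ G ab∈G e
      a∉ (there a∈) with ∈-++⁻ Y₂ a∈
      ... | inj₁ a∈Y₂        = disj a a∈X (bY₂⊆Y (there a∈Y₂))
      ... | inj₂ (here refl) = proj₂ (proj₂ (Unique-++⁻ (X₁ ++ a ∷ X₂)
                                 (AllPairs.tail (Unique-segment A x (X₁ ++ a ∷ X₂) y B (proj₂ (proj₂ ps)))))) a∈X (here refl)
    partsT : Unique A × Unique (x ∷ (Y₁ ++ b ∷ Y₂) ++ y ∷ B) × A # (x ∷ (Y₁ ++ b ∷ Y₂) ++ y ∷ B)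
    partsT = Unique-++⁻ A uT
    bY₂∉A′ : ∀ {z} → z ∈ b ∷ Y₂ → z ∉ A ++ x ∷ X₁
    bY₂∉A′ z∈ z∈A′ with ∈-++⁻ A z∈A′
    ... | inj₁ z∈A          = proj₂ (proj₂ partsT) z∈A (there (∈-++⁺ˡ (bY₂⊆Y z∈)))
    ... | inj₂ (here refl)  = Unique.Unique[x∷xs]⇒x∉xs (Unique-segment A x (Y₁ ++ b ∷ Y₂) y B uT) (∈-++⁺ˡ (bY₂⊆Y z∈))
    ... | inj₂ (there z∈X₁) = disj _ (∈-++⁺ˡ z∈X₁) (bY₂⊆Y z∈)
    bY₂∉B : ∀ {z} → z ∈ b ∷ Y₂ → z ∉ B
    bY₂∉B z∈ z∈B = proj₂ (proj₂ (Unique-++⁻ (Y₁ ++ b ∷ Y₂) (AllPairs.tail (proj₁ (proj₂ partsT))))) (bY₂⊆Y z∈) (there z∈B)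
    new-chain : Chain G (a ∷ (b ∷ Y₂) ++ [ y ])
    new-chain = step ab∈G (proj₁ (Chain-++⁻ (b ∷ Y₂) y B
                  (proj₂ (Chain-++⁻ (A ++ x ∷ Y₁) b (Y₂ ++ y ∷ B) (subst (Chain G) T≡ (proj₁ (proj₂ pt)))))))

  segment-split : ∀ A x (X : List V) y B P a Mi b Q → x ∷ X ++ [ y ] ≡ P ++ a ∷ Mi ++ b ∷ Q →
    A ++ x ∷ X ++ y ∷ B ≡ (A ++ P) ++ a ∷ Mi ++ b ∷ (Q ++ B)
  segment-split A x X y B P a Mi b Q seg≡ = begin
    A ++ x ∷ X ++ y ∷ B                   ≡⟨ cong (λ t → A ++ x ∷ t) (sym (++-assoc X [ y ] B)) ⟩
    A ++ (x ∷ X ++ [ y ]) ++ B            ≡⟨ cong (λ t → A ++ t ++ B) seg≡ ⟩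
    A ++ (P ++ a ∷ Mi ++ b ∷ Q) ++ B      ≡⟨ cong (A ++_) (++-assoc P (a ∷ Mi ++ b ∷ Q) B) ⟩
    A ++ P ++ a ∷ (Mi ++ b ∷ Q) ++ B      ≡⟨ sym (++-assoc A P _) ⟩
    (A ++ P) ++ a ∷ (Mi ++ b ∷ Q) ++ B    ≡⟨ cong (λ t → (A ++ P) ++ a ∷ t) (++-assoc Mi (b ∷ Q) B) ⟩
    (A ++ P) ++ a ∷ Mi ++ b ∷ (Q ++ B)    ∎
    where open ≡-Reasoning

  shortcut-sum : ∀ A a (Mi : List V) b B → Unique (A ++ a ∷ Mi ++ b ∷ B) → Unique (A ++ a ∷ b ∷ B) →
    (consec (A ++ a ∷ Mi ++ b ∷ B) ⊕ consec (A ++ a ∷ b ∷ B)) ≐ (consec (a ∷ Mi ++ [ b ]) ⊕ link a b)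
  shortcut-sum A a Mi b B u₁ u₂ i j =
    trans (replacement-sum A a Mi [] b B u₁ u₂ i j) (cong (consec (a ∷ Mi ++ [ b ]) i j xor_) (∨-identityʳ _))

  ∉-rim : ∀ x (X Y : List V) y {c} → c ∉ x ∷ X ++ [ y ] → c ∉ x ∷ Y ++ [ y ] → c ∉ x ∷ X ++ y ∷ reverse Y
  ∉-rim x X Y y c∉₁ c∉₂ (here e) = c∉₁ (here e)
  ∉-rim x X Y y c∉₁ c∉₂ (there c∈) with ∈-++⁻ X c∈
  ... | inj₁ c∈X          = c∉₁ (there (∈-++⁺ˡ c∈X))
  ... | inj₂ (here e)     = c∉₁ (there (∈-++⁺ʳ X (here e)))
  ... | inj₂ (there c∈rY) = c∉₂ (there (∈-++⁺ˡ {ys = [ y ]} (Any.reverse⁻ c∈rY)))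

  Replacement : List V → List V → Set
  Replacement S T = Σ (List V) λ A → Σ (List V) λ B → Σ V λ x → Σ V λ y → Σ (List V) λ X → Σ (List V) λ Y →
    S ≡ A ++ x ∷ X ++ y ∷ B × T ≡ A ++ x ∷ Y ++ y ∷ B × (∀ z → z ∈ X → z ∉ Y)

  shortcut-Replacement : ∀ A x (X Y : List V) y B P a Mi b Q → x ∷ X ++ [ y ] ≡ P ++ a ∷ Mi ++ b ∷ Q →
    Unique ((A ++ P) ++ a ∷ b ∷ (Q ++ B)) → (∀ z → z ∈ X → z ∉ Y) →
    Replacement ((A ++ P) ++ a ∷ b ∷ (Q ++ B)) (A ++ x ∷ Y ++ y ∷ B)
  shortcut-Replacement A x X Y y B P a Mi b Q seg≡ u disj = A , B , x , y , X′ , Y , S′≡ , refl , disj′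
    where
    X′ : List V
    X′ = proj₁ (cut-keeps-ends x X y P a Mi b Q seg≡)
    seg′≡ : x ∷ X′ ++ [ y ] ≡ P ++ a ∷ b ∷ Q
    seg′≡ = proj₂ (cut-keeps-ends x X y P a Mi b Q seg≡)
    S′≡ : (A ++ P) ++ a ∷ b ∷ (Q ++ B) ≡ A ++ x ∷ X′ ++ y ∷ B
    S′≡ = sym (segment-split A x X′ y B P a [] b Q seg′≡)
    seg′-unique : Unique (x ∷ X′ ++ [ y ])
    seg′-unique = Unique-segment A x X′ y B (subst Unique S′≡ u)
    disj′ : ∀ z → z ∈ X′ → z ∉ Y
    disj′ z z∈X′ z∈Y with subst (z ∈_) (sym seg≡) (∈-uncut P a Mi b Q (subst (z ∈_) seg′≡ (there (∈-++⁺ˡ z∈X′))))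
    ... | here refl = Unique.Unique[x∷xs]⇒x∉xs seg′-unique (∈-++⁺ˡ z∈X′)
    ... | there z∈ with ∈-++⁻ X z∈
    ...   | inj₁ z∈X         = disj z z∈X z∈Y
    ...   | inj₂ (here refl) = proj₂ (proj₂ (Unique-++⁻ X′ (AllPairs.tail seg′-unique))) z∈X′ (here refl)

-- The path graph

module PathGraph {n} (G : Graph n) (u v : Fin n) (C : Mat n → Set) (σ : Mat n) where

  private
    V : Set
    V = Fin n

  AdjC : UVPath G u v → UVPath G u v → Set
  AdjC = AdjacentC {G = G} {u} {v} C

  AdjC-sym : ∀ {S T} → AdjC S T → AdjC T S
  AdjC-sym {s , _} {t , _} ((S≢T , A , B , x , y , X , Y , e₁ , e₂ , disj) , Δ∈C) =
    ((λ e → S≢T (sym e)) , A , B , x , y , Y , X , e₂ , e₁ , (λ z z∈Y z∈X → disj z z∈X z∈Y)) ,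
    subst C (Mat-ext _ _ λ i j → trans (entry-Δ (edgesOf s) (edgesOf t) i j)
                                 (trans (xor-comm (entry (edgesOf s) i j) _) (sym (entry-Δ (edgesOf t) (edgesOf s) i j)))) Δ∈C

  Star-reverse : ∀ {S T} → Star AdjC S T → Star AdjC T S
  Star-reverse ε        = ε
  Star-reverse {S} (_◅_ {j = R} s ss) = Star-reverse ss ◅◅ (AdjC-sym {S} {R} s ◅ ε)

  adjacentC : ∀ {S T : UVPath G u v} {h : Edges} → (consec (proj₁ S) ⊕ consec (proj₁ T)) ≐ h →
    (∀ M → entry M ≐ h → C M) → ∀ {i j} → h i j ≡ true → Replacement (proj₁ S) (proj₁ T) → AdjC S T
  adjacentC {s , _} {t , _} {h} Δ≐h h∈C {i} {j} hij rep = (s≢t , rep) , h∈C _ Δ≐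
    where
    s≢t : s ≢ t
    s≢t refl = false≢true (trans (sym (xor-same (consec s i j))) (trans (Δ≐h i j) hij))
    Δ≐ : entry (edgesOf s Δ edgesOf t) ≐ h
    Δ≐ i j = trans (entry-Δ (edgesOf s) (edgesOf t) i j)
                   (trans (cong₂ _xor_ (entry-edgesOf s i j) (entry-edgesOf t i j)) (Δ≐h i j))

  record ChordCycles (a b : V) (Mi N : List V) : Set where
    field
      first∈C  : ∀ M → entry M ≐ addLink (a ∷ Mi ++ [ b ]) a b → C M
      second∈C : ∀ M → entry M ≐ addLink (b ∷ N ++ [ a ]) a b → C M
      first≐   : addLink (a ∷ Mi ++ [ b ]) a b ≐ (consec (a ∷ Mi ++ [ b ]) ⊕ link a b)
      second≐  : addLink (b ∷ N ++ [ a ]) a b ≐ (addLink (a ∷ Mi ++ [ b ]) a b ⊕ entry σ)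

  -- For every reading of σ as the cycle  a Mi b N a , both cycles of σ + ab through ab lie in C.
  Chord : V → V → Set
  Chord a b = Edge G a b × (∀ Mi N → Unique (a ∷ Mi ++ b ∷ N) →
    entry σ ≐ consec (closed a (Mi ++ b ∷ N)) → ChordCycles a b Mi N)

  chord-cycles : ∀ {a b α β} → C α → C β →
    CycleIn (entry σ ∪ₑ link a b) (entry α) → CycleIn (entry σ ∪ₑ link a b) (entry β) →
    entry σ ≐ (entry α ⊕ entry β) → entry σ a b ≡ false →
    ∀ Mi N → Unique (a ∷ Mi ++ b ∷ N) → entry σ ≐ consec (closed a (Mi ++ b ∷ N)) → ChordCycles a b Mi N
  chord-cycles {a} {b} {α} {β} α∈C β∈C cα cβ σ≐α⊕β ab∉σ Mi N uniq σ≐rim = record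
    { first∈C  = [ (λ (α≐ , _) → member α∈C α≐) , (λ (_ , β≐) → member β∈C β≐) ]′ pair
    ; second∈C = [ (λ (_ , β≐) → member β∈C β≐) , (λ (α≐ , _) → member α∈C α≐) ]′ pair
    ; first≐   = first-cycle≐arc⊕chord a Mi b N uniq ab∉rim
    ; second≐  = λ i j → trans (second-cycle≐first⊕rim a Mi b N uniq ab∉rim i j)
                               (cong (addLink (a ∷ Mi ++ [ b ]) a b i j xor_) (sym (σ≐rim i j)))
    }
    where
    ab∉rim : consec (closed a (Mi ++ b ∷ N)) a b ≡ false
    ab∉rim = trans (sym (σ≐rim a b)) ab∉σ
    on-rim : ∀ {γ} → CycleIn (entry σ ∪ₑ link a b) γ → CycleIn (consec (closed a (Mi ++ b ∷ N)) ∪ₑ link a b) γ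
    on-rim = CycleIn-mono λ i j h → trans (cong (_∨ link a b i j) (sym (σ≐rim i j))) h
    pair : (entry α ≐ addLink (a ∷ Mi ++ [ b ]) a b × entry β ≐ addLink (b ∷ N ++ [ a ]) a b) ⊎
           (entry α ≐ addLink (b ∷ N ++ [ a ]) a b × entry β ≐ addLink (a ∷ Mi ++ [ b ]) a b)
    pair = theta-cycles a Mi b N uniq ab∉rim (on-rim cα) (on-rim cβ) (λ i j → trans (sym (σ≐rim i j)) (σ≐α⊕β i j))
    member : ∀ {γ h} → C γ → entry γ ≐ h → ∀ M → entry M ≐ h → C M
    member γ∈C γ≐h M M≐h = subst C (Mat-ext _ M λ i j → trans (γ≐h i j) (sym (M≐h i j))) γ∈C

  module Surgery (A B : List V) (x y : V) (X Y : List V)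
                 (ps : IsPath G u v (A ++ x ∷ X ++ y ∷ B)) (pt : IsPath G u v (A ++ x ∷ Y ++ y ∷ B))
                 (disj : ∀ z → z ∈ X → z ∉ Y) (S≢T : A ++ x ∷ X ++ y ∷ B ≢ A ++ x ∷ Y ++ y ∷ B)
                 (σ≐ : entry σ ≐ (consec (A ++ x ∷ X ++ y ∷ B) ⊕ consec (A ++ x ∷ Y ++ y ∷ B))) where

    S T : List V
    S = A ++ x ∷ X ++ y ∷ B
    T = A ++ x ∷ Y ++ y ∷ B

    uS : Unique S
    uS = proj₂ (proj₂ ps)
    uT : Unique T
    uT = proj₂ (proj₂ pt)

    rim-unique : Unique (x ∷ X ++ y ∷ reverse Y)
    rim-unique = proj₁ (replacement-cycle A x X Y y B uS uT (λ {z} → disj z) S≢T)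

    σ≐rim : entry σ ≐ consec (closed x (X ++ y ∷ reverse Y))
    σ≐rim i j = trans (σ≐ i j) (proj₂ (replacement-cycle A x X Y y B uS uT (λ {z} → disj z) S≢T) i j)

    rim-from : ∀ P a Mi b Q → x ∷ X ++ y ∷ reverse Y ≡ P ++ a ∷ Mi ++ b ∷ Q →
      Unique (a ∷ Mi ++ b ∷ Q ++ P) × entry σ ≐ consec (closed a (Mi ++ b ∷ Q ++ P))
    rim-from P a Mi b Q eq with rotate x (X ++ y ∷ reverse Y) P a (Mi ++ b ∷ Q) eq rim-unique
    ... | u′ , rotated = subst (λ t → Unique (a ∷ t)) assoc u′ ,
                         λ i j → trans (σ≐rim i j) (trans (rotated i j) (cong (λ t → consec (closed a t) i j) assoc))
      where
      assoc : (Mi ++ b ∷ Q) ++ P ≡ Mi ++ b ∷ Q ++ P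
      assoc = ++-assoc Mi (b ∷ Q) P

    -- The second step's cycle is  first ⊕ σ , by the xor-triangle through S.
    detour : ∀ {a b Mi N} R (pr : IsPath G u v R) → ChordCycles a b Mi N →
      (consec S ⊕ consec R) ≐ addLink (a ∷ Mi ++ [ b ]) a b →
      Replacement S R → Replacement R T → Star AdjC (S , ps) (T , pt)
    detour {a} {b} {Mi} {N} R pr cc S⊕R rep₁ rep₂ =
      _◅_ {j = R , pr} (adjacentC {S , ps} {R , pr} S⊕R first∈C (∨-trueʳ (consec (a ∷ Mi ++ [ b ]) a b) (link-ab a b)) rep₁)
      (adjacentC {R , pr} {T , pt} R⊕T second∈C (∨-trueʳ (consec (b ∷ N ++ [ a ]) a b) (link-ab a b)) rep₂ ◅ ε)
      where
      open ChordCycles cc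
      R⊕T : (consec R ⊕ consec T) ≐ addLink (b ∷ N ++ [ a ]) a b
      R⊕T i j = begin
        consec R i j xor consec T i j
          ≡⟨ sym (xor-cancelˡ (consec S i j) (consec R i j) (consec T i j)) ⟩
        (consec S i j xor consec R i j) xor (consec S i j xor consec T i j)
          ≡⟨ cong₂ _xor_ (S⊕R i j) (sym (σ≐ i j)) ⟩
        addLink (a ∷ Mi ++ [ b ]) a b i j xor entry σ i j
          ≡⟨ sym (second≐ i j) ⟩
        addLink (b ∷ N ++ [ a ]) a b i j ∎
        where open ≡-Reasoning

    chord-on-S : ∀ a b P Mi Q → x ∷ X ++ [ y ] ≡ P ++ a ∷ Mi ++ b ∷ Q → Chord a b → Star AdjC (S , ps) (T , pt)
    chord-on-S a b P Mi Q seg≡ (ab∈G , chord) = detour S′ ps′ cc S⊕S′ rep₁ rep₂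
      where
      A′ B′ S′ : List V
      A′ = A ++ P
      B′ = Q ++ B
      S′ = A′ ++ a ∷ b ∷ B′
      rotated : Unique (a ∷ Mi ++ b ∷ (Q ++ reverse Y) ++ P) × entry σ ≐ consec (closed a (Mi ++ b ∷ (Q ++ reverse Y) ++ P))
      rotated = rim-from P a Mi b (Q ++ reverse Y) (segment-split [] x X y (reverse Y) P a Mi b Q seg≡)
      cc : ChordCycles a b Mi ((Q ++ reverse Y) ++ P)
      cc = chord Mi ((Q ++ reverse Y) ++ P) (proj₁ rotated) (proj₂ rotated)
      S≡ : S ≡ A′ ++ a ∷ Mi ++ b ∷ B′
      S≡ = segment-split A x X y B P a Mi b Q seg≡
      ps′ : IsPath G u v S′
      ps′ = IsPath-splice A′ a Mi [] b B′ (subst (IsPath G u v) S≡ ps) (step ab∈G (single b))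
              (Unique-∷⁺ (λ { (here e) → Edge⇒≢ G ab∈G e }) Unique-[ b ]) (λ ()) (λ ())
      S⊕S′ : (consec S ⊕ consec S′) ≐ addLink (a ∷ Mi ++ [ b ]) a b
      S⊕S′ i j = trans (cong (λ t → consec t i j xor consec S′ i j) S≡)
                   (trans (shortcut-sum A′ a Mi b B′ (subst Unique S≡ uS) (proj₂ (proj₂ ps′)) i j)
                          (sym (ChordCycles.first≐ cc i j)))
      rep₁ : Replacement S S′
      rep₁ = A′ , B′ , a , b , Mi , [] , S≡ , refl , λ _ _ ()
      rep₂ : Replacement S′ T
      rep₂ = shortcut-Replacement A x X Y y B P a Mi b Q seg≡ (proj₂ (proj₂ ps′)) disj

  chord-across : ∀ A B x y X Y (ps : IsPath G u v (A ++ x ∷ X ++ y ∷ B)) (pt : IsPath G u v (A ++ x ∷ Y ++ y ∷ B)) →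
    (disj : ∀ z → z ∈ X → z ∉ Y) (S≢T : A ++ x ∷ X ++ y ∷ B ≢ A ++ x ∷ Y ++ y ∷ B) →
    (σ≐ : entry σ ≐ (consec (A ++ x ∷ X ++ y ∷ B) ⊕ consec (A ++ x ∷ Y ++ y ∷ B))) →
    ∀ a b → a ∈ X → b ∈ Y → Chord a b → Star AdjC (_ , ps) (_ , pt)
  chord-across A B x y X Y ps pt disj S≢T σ≐ a b a∈X b∈Y (ab∈G , chord) with ∈-∃++ a∈X | ∈-∃++ b∈Y
  ... | X₁ , X₂ , refl | Y₁ , Y₂ , refl = detour R pr cc S⊕R rep₁ rep₂
    where
    open Surgery A B x y (X₁ ++ a ∷ X₂) (Y₁ ++ b ∷ Y₂) ps pt disj S≢T σ≐
    Mi A′ R : List V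
    Mi = X₂ ++ y ∷ reverse Y₂
    A′ = A ++ x ∷ X₁
    R  = A′ ++ a ∷ (b ∷ Y₂) ++ y ∷ B
    rotated : Unique (a ∷ Mi ++ b ∷ reverse Y₁ ++ x ∷ X₁) × entry σ ≐ consec (closed a (Mi ++ b ∷ reverse Y₁ ++ x ∷ X₁))
    rotated = rim-from (x ∷ X₁) a Mi b (reverse Y₁) (crossing-rim x X₁ a X₂ y Y₁ b Y₂)
    cc : ChordCycles a b Mi (reverse Y₁ ++ x ∷ X₁)
    cc = chord Mi (reverse Y₁ ++ x ∷ X₁) (proj₁ rotated) (proj₂ rotated)
    S≡ : S ≡ A′ ++ a ∷ X₂ ++ y ∷ B
    S≡ = trans (cong (λ t → A ++ x ∷ t) (++-assoc X₁ (a ∷ X₂) (y ∷ B))) (sym (++-assoc A (x ∷ X₁) _))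
    pr : IsPath G u v R
    pr = crossing-IsPath A B x y X₁ a X₂ Y₁ b Y₂ ps pt disj ab∈G
    arc-unique : Unique (a ∷ Mi ++ [ b ])
    arc-unique = proj₁ (Unique-++⁻ (a ∷ Mi ++ [ b ])
                   (subst (λ t → Unique (a ∷ t)) (sym (++-assoc Mi [ b ] _)) (proj₁ rotated)))
    S⊕R : (consec S ⊕ consec R) ≐ addLink (a ∷ Mi ++ [ b ]) a b
    S⊕R i j = trans (cong (λ t → consec t i j xor consec R i j) S≡)
                (trans (crossing-sum A′ a X₂ y B b Y₂ (subst Unique S≡ uS) (proj₂ (proj₂ pr)) arc-unique i j)
                       (sym (ChordCycles.first≐ cc i j)))
    rep₁ : Replacement S R
    rep₁ = A′ , B , a , y , X₂ , b ∷ Y₂ , S≡ , refl , λ z z∈X₂ z∈bY₂ → disj z (∈-++⁺ʳ X₁ (there z∈X₂)) (∈-++⁺ʳ Y₁ z∈bY₂)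
    R≡ : R ≡ A ++ x ∷ (X₁ ++ [ a ]) ++ b ∷ (Y₂ ++ y ∷ B)
    R≡ = trans (++-assoc A (x ∷ X₁) _) (cong (λ t → A ++ x ∷ t) (sym (++-assoc X₁ [ a ] _)))
    rep₂ : Replacement R T
    rep₂ = A , Y₂ ++ y ∷ B , x , b , X₁ ++ [ a ] , Y₁ , R≡ , cong (λ t → A ++ x ∷ t) (++-assoc Y₁ (b ∷ Y₂) (y ∷ B)) , disj′
      where
      disj′ : ∀ z → z ∈ X₁ ++ [ a ] → z ∉ Y₁
      disj′ z z∈ z∈Y₁ with ∈-++⁻ X₁ z∈
      ... | inj₁ z∈X₁        = disj z (∈-++⁺ˡ z∈X₁) (∈-++⁺ˡ z∈Y₁)
      ... | inj₂ (here refl) = disj z a∈X (∈-++⁺ˡ z∈Y₁)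

  chord-on-segment : ∀ A B x y X Y (ps : IsPath G u v (A ++ x ∷ X ++ y ∷ B)) (pt : IsPath G u v (A ++ x ∷ Y ++ y ∷ B)) →
    (disj : ∀ z → z ∈ X → z ∉ Y) (S≢T : A ++ x ∷ X ++ y ∷ B ≢ A ++ x ∷ Y ++ y ∷ B) →
    (σ≐ : entry σ ≐ (consec (A ++ x ∷ X ++ y ∷ B) ⊕ consec (A ++ x ∷ Y ++ y ∷ B))) →
    ∀ a b → a ∈ x ∷ X ++ [ y ] → b ∈ x ∷ X ++ [ y ] → Chord a b → Chord b a → Star AdjC (_ , ps) (_ , pt)
  chord-on-segment A B x y X Y ps pt disj S≢T σ≐ a b a∈ b∈ ab ba
    with two-members-split (x ∷ X ++ [ y ]) a∈ b∈ (Edge⇒≢ G (proj₁ ab))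
  ... | inj₁ (P , Mi , Q , eq) = chord-on-S a b P Mi Q eq ab
    where open Surgery A B x y X Y ps pt disj S≢T σ≐
  ... | inj₂ (P , Mi , Q , eq) = chord-on-S b a P Mi Q eq ba
    where open Surgery A B x y X Y ps pt disj S≢T σ≐

  module SigmaSteps (C-cycles : ∀ τ → C τ → IsCycle G τ) (σ-cycle : IsCycle G σ) (Δ* : PropertyΔ* G C σ) where

    σ-in-σ : CycleIn (entry σ) (entry σ)
    σ-in-σ = IsCycle⇒CycleIn σ σ-cycle (λ _ _ p → p)

    resolve : ∀ A B x y X Y (ps : IsPath G u v (A ++ x ∷ X ++ y ∷ B)) (pt : IsPath G u v (A ++ x ∷ Y ++ y ∷ B)) →
      (disj : ∀ z → z ∈ X → z ∉ Y) (S≢T : A ++ x ∷ X ++ y ∷ B ≢ A ++ x ∷ Y ++ y ∷ B) →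
      (σ≐ : entry σ ≐ (consec (A ++ x ∷ X ++ y ∷ B) ⊕ consec (A ++ x ∷ Y ++ y ∷ B))) →
      ∀ a b → Edge G a b → entry σ a b ≡ false → ∀ α β → C α → C β →
      α ⊆ᴱ addEdge σ a b → β ⊆ᴱ addEdge σ a b → σ ≡ α Δ β → Star AdjC (_ , ps) (_ , pt)
    resolve A B x y X Y ps pt disj S≢T σ≐ a b ab∈G ab∉σ α β α∈C β∈C α⊆ β⊆ σ≡ =
      dispatch (a ∈? L₁) (a ∈? L₂) (b ∈? L₁) (b ∈? L₂)
      where
      open Surgery A B x y X Y ps pt disj S≢T σ≐ using (rim-unique; σ≐rim)
      open DecMembership (_≟_ {n}) using (_∈?_)
      L₁ L₂ : List V
      L₁ = x ∷ X ++ [ y ]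
      L₂ = x ∷ Y ++ [ y ]
      σ≐α⊕β : entry σ ≐ (entry α ⊕ entry β)
      σ≐α⊕β i j = trans (cong (λ M → entry M i j) σ≡) (entry-Δ α β i j)
      in-σ+ab : ∀ {γ} → C γ → γ ⊆ᴱ addEdge σ a b → CycleIn (entry σ ∪ₑ link a b) (entry γ)
      in-σ+ab {γ} γ∈C γ⊆ = IsCycle⇒CycleIn γ (C-cycles γ γ∈C) (λ i j p → trans (sym (entry-addEdge σ a b i j)) (γ⊆ i j p))
      cα : CycleIn (entry σ ∪ₑ link a b) (entry α)
      cα = in-σ+ab α∈C α⊆
      cβ : CycleIn (entry σ ∪ₑ link a b) (entry β)
      cβ = in-σ+ab β∈C β⊆
      swapped : ∀ {γ} → CycleIn (entry σ ∪ₑ link a b) γ → CycleIn (entry σ ∪ₑ link b a) γ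
      swapped = CycleIn-mono λ i j p → trans (cong (entry σ i j ∨_) (sym (link-swap a b i j))) p
      ab : Chord a b
      ab = ab∈G , chord-cycles α∈C β∈C cα cβ σ≐α⊕β ab∉σ
      ba : Chord b a
      ba = trans (Graph.sym G b a) ab∈G ,
           chord-cycles α∈C β∈C (swapped cα) (swapped cβ) σ≐α⊕β (trans (CycleIn.symmetric σ-in-σ b a) ab∉σ)
      no-pendant : ∀ c d → c ∉ L₁ → c ∉ L₂ → c ≢ d →
        CycleIn (entry σ ∪ₑ link c d) (entry α) → CycleIn (entry σ ∪ₑ link c d) (entry β) → ⊥
      no-pendant c d c∉₁ c∉₂ c≢d cα′ cβ′ =
        pendant-chord-impossible x (X ++ y ∷ reverse Y) rim-unique c d (∉-rim x X Y y c∉₁ c∉₂) c≢d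
          (on-rim cα′) (on-rim cβ′) (λ i j → trans (sym (σ≐rim i j)) (σ≐α⊕β i j))
        where
        on-rim : ∀ {γ} → CycleIn (entry σ ∪ₑ link c d) γ → CycleIn (consec (closed x (X ++ y ∷ reverse Y)) ∪ₑ link c d) γ
        on-rim = CycleIn-mono λ i j p → trans (cong (_∨ link c d i j) (sym (σ≐rim i j))) p
      dispatch : Dec (a ∈ L₁) → Dec (a ∈ L₂) → Dec (b ∈ L₁) → Dec (b ∈ L₂) → Star AdjC (_ , ps) (_ , pt)
      dispatch (yes a∈₁) _ (yes b∈₁) _ = chord-on-segment A B x y X Y ps pt disj S≢T σ≐ a b a∈₁ b∈₁ ab ba
      dispatch _ (yes a∈₂) _ (yes b∈₂) =
        Star-reverse (chord-on-segment A B x y Y X pt ps (λ z z∈Y z∈X → disj z z∈X z∈Y) (λ e → S≢T (sym e))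
                        (λ i j → trans (σ≐ i j) (xor-comm (consec (A ++ x ∷ X ++ y ∷ B) i j) _)) a b a∈₂ b∈₂ ab ba)
      dispatch (no a∉₁) (no a∉₂) _ _ = ⊥-elim (no-pendant a b a∉₁ a∉₂ (Edge⇒≢ G ab∈G) cα cβ)
      dispatch _ _ (no b∉₁) (no b∉₂) = ⊥-elim (no-pendant b a b∉₁ b∉₂ (Edge⇒≢ G (proj₁ ba)) (swapped cα) (swapped cβ))
      dispatch (yes a∈₁) (no a∉₂) (no b∉₁) (yes b∈₂) =
        chord-across A B x y X Y ps pt disj S≢T σ≐ a b (∈-interior x X y Y a∈₁ a∉₂) (∈-interior x Y y X b∈₂ b∉₁) ab
      dispatch (no a∉₁) (yes a∈₂) (yes b∈₁) (no b∉₂) =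
        chord-across A B x y X Y ps pt disj S≢T σ≐ b a (∈-interior x X y Y b∈₁ b∉₂) (∈-interior x Y y X a∈₂ a∉₁) ba

    σ-step : ∀ (S T : UVPath G u v) → Adjacent S T → edgesOf (proj₁ S) Δ edgesOf (proj₁ T) ≡ σ → Star AdjC S T
    σ-step (_ , ps) (_ , pt) (S≢T , A , B , x , y , X , Y , refl , refl , disj) Δ≡σ
      with Δ* σ (IsCycle⇒IsUnicycle σ σ-cycle) (λ _ _ p → p)
    ... | a , b , ab∈G , ab∉σ , α , β , α∈C , β∈C , α⊆ , β⊆ , σ≡ =
      resolve A B x y X Y ps pt disj S≢T σ≐ a b ab∈G ab∉σ α β α∈C β∈C α⊆ β⊆ σ≡
      where
      σ≐ : entry σ ≐ (consec (A ++ x ∷ X ++ y ∷ B) ⊕ consec (A ++ x ∷ Y ++ y ∷ B))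
      σ≐ i j = trans (cong (λ M → entry M i j) (sym Δ≡σ))
                 (trans (entry-Δ (edgesOf (A ++ x ∷ X ++ y ∷ B)) _ i j)
                        (cong₂ _xor_ (entry-edgesOf (A ++ x ∷ X ++ y ∷ B) i j) (entry-edgesOf (A ++ x ∷ Y ++ y ∷ B) i j)))

    C∪σ-step⇒C-steps : ∀ {S T} → AdjacentC {G = G} {u} {v} (C ∪｛ σ ｝) S T → Star AdjC S T
    C∪σ-step⇒C-steps {S} {T} (adj , inj₁ Δ∈C) = _◅_ {j = T} (adj , Δ∈C) ε
    C∪σ-step⇒C-steps {S} {T} (adj , inj₂ Δ≡σ) = σ-step S T adj Δ≡σ

lemma4 : ∀ {n} (G : Graph n) → TwoConnected G → (u v : Fin n) →
    (C : Mat n → Set) → (∀ τ → C τ → IsCycle G τ) →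
    (σ : Mat n) → IsCycle G σ → PropertyΔ* G C σ →
    PathGraphConnected G u v (C ∪｛ σ ｝) ⇔ PathGraphConnected G u v C
-- The equivalence holds without 2-connectivity.
lemma4 G _ u v C C-cycles σ σ-cycle Δ* = mk⇔
  (λ connected S T → Star.kleisliStar id C∪σ-step⇒C-steps (connected S T))
  (λ connected S T → Star.map (λ (adj , Δ∈C) → adj , inj₁ Δ∈C) (connected S T))
  where open PathGraph.SigmaSteps G u v C σ C-cycles σ-cycle Δ*
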